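{- Let $\mathcal L$ be the family of non-plane rooted trees whose internal nodes have at least two children, with leaves labeled, size being the number of leaves, and $L(z)=\sum_{n\ge1}\frac{\ell_n}{n!}z^n$ its exponential generating function ($\ell_n$ = number of such trees with leaves labeled $1,\dots,n$). Let $L^{\mathrm{even}}(z)=\sum_{n\ge1}\frac{e_n}{(n-1)!}z^{n-1}$ and $L^{\mathrm{odd}}(z)=\sum_{n\ge1}\frac{o_n}{(n-1)!}z^{n-1}$, where $e_n$ (resp. $o_n$) is the number of trees of $\mathcal L$ with leaves labeled $1,\dots,n$ in which the leaf labeled $n$ is at even (resp. odd) distance from the root (i.e. these count trees of $\mathcal L$ with one unlabeled marked leaf, a "blossom", at even/odd distance from the root, the blossom not counted in the size). Then $$L^{\mathrm{even}}=\frac1{e^L(2-e^L)},\qquad L^{\mathrm{odd}}=\frac{e^L-1}{e^L(2-e^L)}.$$ -}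

module Defs where

open import Data.Bool using (Bool; true; false; _∧_; if_then_else_; T)
open import Data.Nat as ℕ using (ℕ; zero; suc; _≡ᵇ_; _<ᵇ_; _!; _⊓_)
open import Data.Nat.Properties using (_!≢0)
open import Data.List using (List; []; _∷_; _++_; length; map; foldr; upTo; filterᵇ)
open import Data.Bool.ListAction using (all; any)
open import Data.Product using (Σ)
open import Relation.Binary.PropositionalEquality using (_≡_)
open import Data.Integer using (+_)
open import Data.Rational using (ℚ; 0ℚ; 1ℚ; _+_; _*_; _-_; _/_)

data RT : Set where
  leaf : ℕ → RT
  node : List RT → RT

mutual
  leaves : RT → List ℕ
  leaves (leaf i)  = i ∷ []
  leaves (node ts) = leavesL ts

  leavesL : List RT → List ℕ
  leavesL []       = []
  leavesL (t ∷ ts) = leaves t ++ leavesL ts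

minOf : List ℕ → ℕ
minOf []       = 0
minOf (x ∷ xs) = foldr _⊓_ x xs

minLeaf : RT → ℕ
minLeaf t = minOf (leaves t)

strictlyIncreasing : List ℕ → Bool
strictlyIncreasing []           = true
strictlyIncreasing (x ∷ [])     = true
strictlyIncreasing (x ∷ y ∷ xs) = (x <ᵇ y) ∧ strictlyIncreasing (y ∷ xs)

-- Shape condition: every internal node has at least two children, and
-- (canonical representative of a NON-PLANE tree) the children of each
-- node are listed in strictly increasing order of their smallest leaf
-- label.  Since sibling subtrees have disjoint leaf sets, each non-plane
-- tree has exactly one such representative.
mutual
  shapeOK : RT → Bool
  shapeOK (leaf i)  = true
  shapeOK (node ts) = (2 ℕ.≤ᵇ length ts)
                      ∧ strictlyIncreasing (map minLeaf ts)
                      ∧ shapeOKL ts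

  shapeOKL : List RT → Bool
  shapeOKL []       = true
  shapeOKL (t ∷ ts) = shapeOK t ∧ shapeOKL ts

count : ℕ → List ℕ → ℕ
count i xs = length (filterᵇ (λ x → x ≡ᵇ i) xs)

-- the leaf labels are exactly 0,1,…,n-1, each used once
-- (label k here stands for the paper's label k+1)
labelledBy : ℕ → RT → Bool
labelledBy n t = (length (leaves t) ≡ᵇ n)
                 ∧ all (λ i → count i (leaves t) ≡ᵇ 1) (upTo n)

validTree : ℕ → RT → Bool
validTree n t = shapeOK t ∧ labelledBy n t

Tree : ℕ → Set
Tree n = Σ RT (λ t → T (validTree n t))

_∈ᵇ_ : ℕ → List ℕ → Bool
k ∈ᵇ xs = any (λ x → x ≡ᵇ k) xs

mutual
  depth : ℕ → RT → ℕ
  depth k (leaf i)  = 0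
  depth k (node ts) = suc (depthL k ts)

  depthL : ℕ → List RT → ℕ
  depthL k []       = 0
  depthL k (t ∷ ts) = if k ∈ᵇ leaves t then depth k t else depthL k ts

isEven : ℕ → Bool
isEven zero          = true
isEven (suc zero)    = false
isEven (suc (suc n)) = isEven n

-- trees of 𝓛 on leaves {1,…,n+1} whose leaf n+1 (encoded label n)
-- is at even / odd distance from the root
EvenTree : ℕ → Set
EvenTree m = Σ RT (λ t → T (validTree (suc m) t ∧ isEven (depth m t)))

OddTree : ℕ → Set
OddTree m = Σ RT (λ t → T (validTree (suc m) t ∧ (if isEven (depth m t) then false else true)))

FPS : Set
FPS = ℕ → ℚ

sumQ : List ℚ → ℚ
sumQ = foldr _+_ 0ℚ

constS : ℚ → FPS
constS c zero    = c
constS c (suc n) = 0ℚ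

oneS : FPS
oneS = constS 1ℚ

_+S_ : FPS → FPS → FPS
(f +S g) n = f n + g n

_-S_ : FPS → FPS → FPS
(f -S g) n = f n - g n

_*S_ : FPS → FPS → FPS
(f *S g) n = sumQ (map (λ k → f k * g (n ℕ.∸ k)) (upTo (suc n)))

_^S_ : FPS → ℕ → FPS
f ^S zero  = oneS
f ^S suc k = f *S (f ^S k)

1/! : ℕ → ℚ
1/! k = ((+ 1) / (k !)) {{k !≢0}}

-- exp(f) = Σ_k f^k / k!, for f with zero constant term; the coefficient
-- of z^n only involves k ≤ n.
expS : FPS → FPS
expS f n = sumQ (map (λ k → 1/! k * (f ^S k) n) (upTo (suc n)))

egf : (ℕ → ℕ) → FPS
egf a zero    = 0ℚ
egf a (suc n) = ((+ a (suc n)) / (suc n !)) {{suc n !≢0}}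

-- Σ_{n≥1} a_n z^{n-1} / (n-1)!   (a indexed so that a m = count for n = m+1)
egfShift : (ℕ → ℕ) → FPS
egfShift a m = ((+ a m) / (m !)) {{m !≢0}}

_≈S_ : FPS → FPS → Set
f ≈S g = ∀ n → f n ≡ g n

-- A tree with the marked leaf b is either the leaf b itself or a root whose children are the
-- child c containing b and a nonempty forest; the other labels are distributed between c and
-- the forest, and the depth of b in the tree is one more than its depth in c. Likewise a
-- nonempty forest on labels containing b is the tree containing b, possibly together with a
-- nonempty forest on the other labels. For the exponential generating function F of nonempty
-- forests this reads
--   F′ = L′ (1 + F),   L^even = 1 + L^odd F,   L^odd = L^even F.
-- The first equation is the linear ODE solved by e^L, so 1 + F = e^L; the other two give
-- L^even (1 - F²) = 1 and L^odd = L^even F, while e^L (2 - e^L) = (1 + F)(1 - F) = 1 - F².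

module Submission where

open import Defs

module Enumeration where

  open import Data.Bool using (Bool; true; false; _∧_; _∨_; if_then_else_; T)
  open import Data.Bool.Properties using (T-irrelevant)
  open import Data.Bool.ListAction using (all)
  open import Data.Nat as ℕ using (ℕ; zero; suc; _+_; _*_; _∸_; _≤_; _<_; z≤n; s≤s; _≡ᵇ_; _<ᵇ_; _⊓_; _≟_)
  import Data.Nat.Properties as ℕP
  open import Data.Nat.Induction using (<-rec)
  open import Data.Nat.Solver using (module +-*-Solver)
  open import Data.List using (List; []; _∷_; _++_; length; map; foldr; upTo)
  import Data.List.Properties as ListP
  open import Data.Vec using (Vec; []; _∷_)
  open import Data.Fin using (Fin)
  import Data.Fin.Properties as FinP
  open import Data.Fin.Permutation using (↔⇒≡)
  open import Data.Product using (Σ; _×_; _,_; proj₁; proj₂)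
  open import Data.Product.Function.NonDependent.Propositional using (_×-↔_)
  open import Data.Sum using (_⊎_; inj₁; inj₂)
  open import Data.Sum.Function.Propositional using (_⊎-↔_)
  open import Data.Empty using (⊥; ⊥-elim)
  open import Data.Unit using (tt)
  open import Relation.Nullary using (¬_; yes; no)
  open import Relation.Binary.Definitions using (tri<; tri≈; tri>)
  open import Relation.Binary.PropositionalEquality
  open import Function.Bundles using (_↔_; mk↔ₛ′)
  open import Function.Properties.Inverse using (↔-trans; ↔-sym)
  open +-*-Solver using (solve; _:+_; _:=_)
  open ≡-Reasoning

  ∧-intro : ∀ {a b} → T a → T b → T (a ∧ b)
  ∧-intro {true} {true} _ _ = tt

  ∧-proj₁ : ∀ {a b} → T (a ∧ b) → T a
  ∧-proj₁ {true} _ = tt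

  ∧-proj₂ : ∀ {a b} → T (a ∧ b) → T b
  ∧-proj₂ {true} p = p

  T⇒≡true : ∀ {b} → T b → b ≡ true
  T⇒≡true {true} _ = refl

  ≡true⇒T : ∀ {b} → b ≡ true → T b
  ≡true⇒T refl = tt

  ≡⇒≡ᵇ-true : ∀ {x z} → x ≡ z → (x ≡ᵇ z) ≡ true
  ≡⇒≡ᵇ-true {x} {z} e = T⇒≡true (ℕP.≡⇒≡ᵇ x z e)

  ≢⇒≡ᵇ-false : ∀ {x z} → x ≢ z → (x ≡ᵇ z) ≡ false
  ≢⇒≡ᵇ-false {x} {z} x≢z with x ≡ᵇ z in eq
  ... | true  = ⊥-elim (x≢z (ℕP.≡ᵇ⇒≡ x z (≡true⇒T eq)))
  ... | false = refl

  if-true : ∀ {A : Set} {c} (x y : A) → c ≡ true → (if c then x else y) ≡ x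
  if-true x y refl = refl

  if-false : ∀ {A : Set} {c} (x y : A) → c ≡ false → (if c then x else y) ≡ y
  if-false x y refl = refl

  zero⊎positive : ∀ n → n ≡ 0 ⊎ 1 ≤ n
  zero⊎positive zero    = inj₁ refl
  zero⊎positive (suc n) = inj₂ (s≤s z≤n)

  indicator : ℕ → ℕ → ℕ
  indicator x z = if x ≡ᵇ z then 1 else 0

  indicator-≢ : ∀ {x z} → x ≢ z → indicator x z ≡ 0
  indicator-≢ x≢z = cong (λ c → if c then 1 else 0) (≢⇒≡ᵇ-false x≢z)

  indicator-sym : ∀ x z → indicator x z ≡ indicator z x
  indicator-sym x z with x ≟ z
  ... | yes refl = refl
  ... | no x≢z rewrite ≢⇒≡ᵇ-false x≢z | ≢⇒≡ᵇ-false (λ e → x≢z (sym e)) = refl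

  count-∷ : ∀ x z xs → count z (x ∷ xs) ≡ indicator x z + count z xs
  count-∷ x z xs with x ≟ z
  ... | yes refl rewrite ≡⇒≡ᵇ-true {x} {x} refl = refl
  ... | no x≢z   rewrite ≢⇒≡ᵇ-false x≢z = refl

  count-∷-≡ : ∀ z xs → count z (z ∷ xs) ≡ suc (count z xs)
  count-∷-≡ z xs rewrite ≡⇒≡ᵇ-true {z} {z} refl = refl

  count-∷-≢ : ∀ {x z} xs → x ≢ z → count z (x ∷ xs) ≡ count z xs
  count-∷-≢ xs x≢z rewrite ≢⇒≡ᵇ-false x≢z = refl

  count-++ : ∀ z xs ys → count z (xs ++ ys) ≡ count z xs + count z ys
  count-++ z []       ys = refl
  count-++ z (x ∷ xs) ys = begin
    count z (x ∷ xs ++ ys)                      ≡⟨ count-∷ x z (xs ++ ys) ⟩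
    indicator x z + count z (xs ++ ys)          ≡⟨ cong (indicator x z +_) (count-++ z xs ys) ⟩
    indicator x z + (count z xs + count z ys)   ≡⟨ ℕP.+-assoc (indicator x z) _ _ ⟨
    indicator x z + count z xs + count z ys     ≡⟨ cong (_+ count z ys) (count-∷ x z xs) ⟨
    count z (x ∷ xs) + count z ys               ∎

  _∈ᵐ_ : ℕ → List ℕ → Set
  z ∈ᵐ xs = 1 ≤ count z xs

  here : ∀ x xs → x ∈ᵐ (x ∷ xs)
  here x xs = subst (1 ≤_) (sym (count-∷-≡ x xs)) (s≤s z≤n)

  there : ∀ {z} x xs → z ∈ᵐ xs → z ∈ᵐ (x ∷ xs)
  there {z} x xs z∈xs = ℕP.≤-trans z∈xs (subst (count z xs ≤_) (sym (count-∷ x z xs)) (ℕP.m≤n+m _ _))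

  ∈ᵐ-++⁺ˡ : ∀ {z} xs ys → z ∈ᵐ xs → z ∈ᵐ (xs ++ ys)
  ∈ᵐ-++⁺ˡ {z} xs ys z∈ = subst (1 ≤_) (sym (count-++ z xs ys)) (ℕP.≤-trans z∈ (ℕP.m≤m+n _ _))

  ∈ᵐ-++⁺ʳ : ∀ {z} xs ys → z ∈ᵐ ys → z ∈ᵐ (xs ++ ys)
  ∈ᵐ-++⁺ʳ {z} xs ys z∈ = subst (1 ≤_) (sym (count-++ z xs ys)) (ℕP.≤-trans z∈ (ℕP.m≤n+m _ _))

  ∈ᵇ⇒∈ᵐ : ∀ z xs → z ∈ᵇ xs ≡ true → z ∈ᵐ xs
  ∈ᵇ⇒∈ᵐ z (x ∷ xs) e with x ≟ z
  ... | yes refl = here z xs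
  ... | no x≢z   = there x xs (∈ᵇ⇒∈ᵐ z xs (trans (cong (_∨ z ∈ᵇ xs) (sym (≢⇒≡ᵇ-false x≢z))) e))

  ∉ᵇ⇒count≡0 : ∀ z xs → z ∈ᵇ xs ≡ false → count z xs ≡ 0
  ∉ᵇ⇒count≡0 z []       e = refl
  ∉ᵇ⇒count≡0 z (x ∷ xs) e with x ≟ z
  ... | yes refl with () ← trans (cong (_∨ z ∈ᵇ xs) (sym (≡⇒≡ᵇ-true {z} {z} refl))) e
  ... | no x≢z   = trans (count-∷-≢ xs x≢z) (∉ᵇ⇒count≡0 z xs (trans (cong (_∨ z ∈ᵇ xs) (sym (≢⇒≡ᵇ-false x≢z))) e))

  ∈ᵐ⇒∈ᵇ : ∀ z xs → z ∈ᵐ xs → z ∈ᵇ xs ≡ true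
  ∈ᵐ⇒∈ᵇ z xs z∈xs with z ∈ᵇ xs in eq
  ... | true  = refl
  ... | false with () ← subst (1 ≤_) (∉ᵇ⇒count≡0 z xs eq) z∈xs

  count≡0⇒∉ᵇ : ∀ z xs → count z xs ≡ 0 → z ∈ᵇ xs ≡ false
  count≡0⇒∉ᵇ z xs c≡0 with z ∈ᵇ xs in eq
  ... | false = refl
  ... | true with () ← subst (1 ≤_) c≡0 (∈ᵇ⇒∈ᵐ z xs eq)

  all⇒∈ᵐ : ∀ p xs → T (all p xs) → ∀ z → z ∈ᵐ xs → T (p z)
  all⇒∈ᵐ p (x ∷ xs) h z z∈ with x ≟ z
  ... | yes refl = ∧-proj₁ h
  ... | no x≢z   = all⇒∈ᵐ p xs (∧-proj₂ {p x} h) z (subst (1 ≤_) (count-∷-≢ xs x≢z) z∈)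

  ∈ᵐ⇒all : ∀ p xs → (∀ z → z ∈ᵐ xs → T (p z)) → T (all p xs)
  ∈ᵐ⇒all p []       h = tt
  ∈ᵐ⇒all p (x ∷ xs) h = ∧-intro (h x (here x xs)) (∈ᵐ⇒all p xs (λ z z∈ → h z (there x xs z∈)))

  Distinct : List ℕ → Set
  Distinct S = ∀ z → count z S ≤ 1

  _≈ᵐ_ : List ℕ → List ℕ → Set
  xs ≈ᵐ S = ∀ z → count z xs ≡ count z S

  distinct-∈⇒count≡1 : ∀ S → Distinct S → ∀ z → z ∈ᵐ S → count z S ≡ 1
  distinct-∈⇒count≡1 S dS z z∈ = ℕP.≤-antisym (dS z) z∈

  distinct-∷ : ∀ z S → Distinct S → count z S ≡ 0 → Distinct (z ∷ S)
  distinct-∷ z S dS z∉ x with z ≟ x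
  ... | yes refl = subst (_≤ 1) (sym (trans (count-∷-≡ z S) (cong suc z∉))) ℕP.≤-refl
  ... | no z≢x   = subst (_≤ 1) (sym (count-∷-≢ S z≢x)) (dS x)

  distinct-tail : ∀ y ys → Distinct (y ∷ ys) → Distinct ys
  distinct-tail y ys d z = ℕP.≤-trans (subst (count z ys ≤_) (sym (count-∷ y z ys)) (ℕP.m≤n+m _ _)) (d z)

  distinct-head : ∀ y ys → Distinct (y ∷ ys) → count y ys ≡ 0
  distinct-head y ys d = ℕP.n≤0⇒n≡0 (ℕP.≤-pred (subst (_≤ 1) (count-∷-≡ y ys) (d y)))

  sumOver : (ℕ → ℕ) → List ℕ → ℕ
  sumOver f []       = 0
  sumOver f (x ∷ xs) = f x + sumOver f xs

  sumOver-cong : ∀ {f g} xs → (∀ x → f x ≡ g x) → sumOver f xs ≡ sumOver g xs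
  sumOver-cong []       e = refl
  sumOver-cong (x ∷ xs) e = cong₂ _+_ (e x) (sumOver-cong xs e)

  sumOver-+ : ∀ f g xs → sumOver (λ x → f x + g x) xs ≡ sumOver f xs + sumOver g xs
  sumOver-+ f g []       = refl
  sumOver-+ f g (x ∷ xs) rewrite sumOver-+ f g xs =
    solve 4 (λ a b c d → (a :+ b) :+ (c :+ d) := (a :+ c) :+ (b :+ d)) refl (f x) (g x) (sumOver f xs) (sumOver g xs)

  sumOver-indicator : ∀ x U → sumOver (indicator x) U ≡ count x U
  sumOver-indicator x []      = refl
  sumOver-indicator x (u ∷ U) = trans (cong₂ _+_ (indicator-sym x u) (sumOver-indicator x U)) (sym (count-∷ u x U))

  sumOver-count-swap : ∀ xs U → sumOver (λ i → count i xs) U ≡ sumOver (λ x → count x U) xs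
  sumOver-count-swap []       U = sumOver-zero U
    where
    sumOver-zero : ∀ U → sumOver (λ _ → 0) U ≡ 0
    sumOver-zero []      = refl
    sumOver-zero (u ∷ U) = sumOver-zero U
  sumOver-count-swap (x ∷ xs) U = begin
    sumOver (λ i → count i (x ∷ xs)) U                        ≡⟨ sumOver-cong U (λ i → count-∷ x i xs) ⟩
    sumOver (λ i → indicator x i + count i xs) U              ≡⟨ sumOver-+ (indicator x) (λ i → count i xs) U ⟩
    sumOver (indicator x) U + sumOver (λ i → count i xs) U    ≡⟨ cong₂ _+_ (sumOver-indicator x U) (sumOver-count-swap xs U) ⟩
    count x U + sumOver (λ y → count y U) xs                  ∎

  sumOver-ones : ∀ f S → (∀ i → i ∈ᵐ S → f i ≡ 1) → sumOver f S ≡ length S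
  sumOver-ones f []      h = refl
  sumOver-ones f (x ∷ S) h = cong₂ _+_ (h x (here x S)) (sumOver-ones f S (λ i i∈ → h i (there x S i∈)))

  sumOver-≤1 : ∀ f S → (∀ i → f i ≤ 1) → sumOver f S ≤ length S
  sumOver-≤1 f []      h = z≤n
  sumOver-≤1 f (x ∷ S) h = ℕP.+-mono-≤ (h x) (sumOver-≤1 f S h)

  labelledByᵇ : List ℕ → List ℕ → Bool
  labelledByᵇ S xs = (length xs ≡ᵇ length S) ∧ all (λ i → count i xs ≡ᵇ 1) S

  labelledByᵇ⇒length : ∀ S xs → T (labelledByᵇ S xs) → length xs ≡ length S
  labelledByᵇ⇒length S xs h = ℕP.≡ᵇ⇒≡ _ _ (∧-proj₁ h)

  -- A label z outside S cannot occur in xs: counting the labels of xs over z ∷ S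
  -- gives count z xs + |S| ≤ |xs| = |S|.
  labelledByᵇ⇒≈ᵐ : ∀ S xs → Distinct S → T (labelledByᵇ S xs) → xs ≈ᵐ S
  labelledByᵇ⇒≈ᵐ S xs dS h z with zero⊎positive (count z S)
  ... | inj₂ z∈S = trans (ℕP.≡ᵇ⇒≡ _ 1 (once z z∈S)) (sym (distinct-∈⇒count≡1 S dS z z∈S))
    where
    once = all⇒∈ᵐ _ S (∧-proj₂ {length xs ≡ᵇ length S} h)
  ... | inj₁ z∉S = trans (ℕP.n≤0⇒n≡0 (ℕP.+-cancelʳ-≤ (length S) (count z xs) 0 bound)) (sym z∉S)
    where
    once = all⇒∈ᵐ _ S (∧-proj₂ {length xs ≡ᵇ length S} h)
    ones : sumOver (λ i → count i xs) S ≡ length S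
    ones = sumOver-ones _ S (λ i i∈ → ℕP.≡ᵇ⇒≡ _ 1 (once i i∈))
    bound : count z xs + length S ≤ 0 + length S
    bound = subst (_≤ length S) (cong (count z xs +_) ones)
              (subst (sumOver (λ i → count i xs) (z ∷ S) ≤_) (labelledByᵇ⇒length S xs h)
                (subst (_≤ length xs) (sym (sumOver-count-swap xs (z ∷ S)))
                  (sumOver-≤1 _ xs (distinct-∷ z S dS z∉S))))

  ≈ᵐ⇒labelledByᵇ : ∀ S xs → Distinct S → xs ≈ᵐ S → T (labelledByᵇ S xs)
  ≈ᵐ⇒labelledByᵇ S xs dS xs≈S =
    ∧-intro (ℕP.≡⇒≡ᵇ _ _ length-≡) (∈ᵐ⇒all _ S (λ i i∈ → ℕP.≡⇒≡ᵇ _ 1 (trans (xs≈S i) (distinct-∈⇒count≡1 S dS i i∈))))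
    where
    length-≡ : length xs ≡ length S
    length-≡ = begin
      length xs                           ≡⟨ sumOver-ones (λ x → count x S) xs
                                               (λ i i∈ → distinct-∈⇒count≡1 S dS i (subst (1 ≤_) (xs≈S i) i∈)) ⟨
      sumOver (λ x → count x S) xs        ≡⟨ sumOver-count-swap xs S ⟨
      sumOver (λ i → count i xs) S        ≡⟨ sumOver-cong S xs≈S ⟩
      sumOver (λ i → count i S) S         ≡⟨ sumOver-ones (λ i → count i S) S (distinct-∈⇒count≡1 S dS) ⟩
      length S                            ∎

  ≈ᵐ-labelledByᵇ : ∀ S S' xs → Distinct S → Distinct S' → S ≈ᵐ S' → T (labelledByᵇ S xs) → T (labelledByᵇ S' xs)
  ≈ᵐ-labelledByᵇ S S' xs dS dS' S≈S' h = ≈ᵐ⇒labelledByᵇ S' xs dS' (λ z → trans (labelledByᵇ⇒≈ᵐ S xs dS h z) (S≈S' z))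

  count-upTo-suc : ∀ n z → count z (upTo (suc n)) ≡ count z (upTo n) + indicator n z
  count-upTo-suc n z = begin
    count z (upTo (suc n))               ≡⟨ cong (count z) (ListP.upTo-∷ʳ n) ⟨
    count z (upTo n ++ n ∷ [])           ≡⟨ count-++ z (upTo n) (n ∷ []) ⟩
    count z (upTo n) + count z (n ∷ [])  ≡⟨ cong (count z (upTo n) +_) (trans (count-∷ n z []) (ℕP.+-identityʳ _)) ⟩
    count z (upTo n) + indicator n z     ∎

  count-upTo-≥ : ∀ n z → n ≤ z → count z (upTo n) ≡ 0
  count-upTo-≥ zero    z _    = refl
  count-upTo-≥ (suc n) z n<z = trans (count-upTo-suc n z)
    (cong₂ _+_ (count-upTo-≥ n z (ℕP.<⇒≤ n<z)) (indicator-≢ (ℕP.<⇒≢ n<z)))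

  distinct-upTo : ∀ n → Distinct (upTo n)
  distinct-upTo zero    z = z≤n
  distinct-upTo (suc n) z rewrite count-upTo-suc n z with n ≟ z
  ... | yes refl rewrite count-upTo-≥ n n ℕP.≤-refl | ≡⇒≡ᵇ-true {n} {n} refl = ℕP.≤-refl
  ... | no n≢z   rewrite indicator-≢ n≢z | ℕP.+-identityʳ (count z (upTo n)) = distinct-upTo n z

  ∷-upTo≈upTo-suc : ∀ m → (m ∷ upTo m) ≈ᵐ upTo (suc m)
  ∷-upTo≈upTo-suc m z = trans (count-∷ m z (upTo m)) (trans (ℕP.+-comm (indicator m z) _) (sym (count-upTo-suc m z)))

  distinct-∷-upTo : ∀ m → Distinct (m ∷ upTo m)
  distinct-∷-upTo m z = subst (_≤ 1) (sym (∷-upTo≈upTo-suc m z)) (distinct-upTo (suc m) z)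

  chosen : (ys : List ℕ) → Vec Bool (length ys) → List ℕ
  chosen []       []          = []
  chosen (y ∷ ys) (true ∷ w)  = y ∷ chosen ys w
  chosen (y ∷ ys) (false ∷ w) = chosen ys w

  unchosen : (ys : List ℕ) → Vec Bool (length ys) → List ℕ
  unchosen []       []          = []
  unchosen (y ∷ ys) (true ∷ w)  = unchosen ys w
  unchosen (y ∷ ys) (false ∷ w) = y ∷ unchosen ys w

  trues : ∀ {m} → Vec Bool m → ℕ
  trues []          = 0
  trues (true ∷ w)  = suc (trues w)
  trues (false ∷ w) = trues w

  falses : ∀ {m} → Vec Bool m → ℕ
  falses []          = 0
  falses (true ∷ w)  = falses w
  falses (false ∷ w) = suc (falses w)

  trues+falses : ∀ {m} (w : Vec Bool m) → trues w + falses w ≡ m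
  trues+falses []          = refl
  trues+falses (true ∷ w)  = cong suc (trues+falses w)
  trues+falses (false ∷ w) = trans (ℕP.+-suc (trues w) (falses w)) (cong suc (trues+falses w))

  length-chosen : ∀ ys w → length (chosen ys w) ≡ trues w
  length-chosen []       []          = refl
  length-chosen (y ∷ ys) (true ∷ w)  = cong suc (length-chosen ys w)
  length-chosen (y ∷ ys) (false ∷ w) = length-chosen ys w

  length-unchosen : ∀ ys w → length (unchosen ys w) ≡ falses w
  length-unchosen []       []          = refl
  length-unchosen (y ∷ ys) (true ∷ w)  = length-unchosen ys w
  length-unchosen (y ∷ ys) (false ∷ w) = cong suc (length-unchosen ys w)

  count-chosen+unchosen : ∀ z ys w → count z (chosen ys w) + count z (unchosen ys w) ≡ count z ys
  count-chosen+unchosen z []       []          = refl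
  count-chosen+unchosen z (y ∷ ys) (true ∷ w)  = begin
    count z (y ∷ chosen ys w) + count z (unchosen ys w)            ≡⟨ cong (_+ count z (unchosen ys w)) (count-∷ y z (chosen ys w)) ⟩
    indicator y z + count z (chosen ys w) + count z (unchosen ys w)  ≡⟨ ℕP.+-assoc (indicator y z) _ _ ⟩
    indicator y z + (count z (chosen ys w) + count z (unchosen ys w)) ≡⟨ cong (indicator y z +_) (count-chosen+unchosen z ys w) ⟩
    indicator y z + count z ys                                     ≡⟨ count-∷ y z ys ⟨
    count z (y ∷ ys)                                               ∎
  count-chosen+unchosen z (y ∷ ys) (false ∷ w) = begin
    count z (chosen ys w) + count z (y ∷ unchosen ys w)              ≡⟨ cong (count z (chosen ys w) +_) (count-∷ y z (unchosen ys w)) ⟩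
    count z (chosen ys w) + (indicator y z + count z (unchosen ys w)) ≡⟨ ℕP.+-comm (count z (chosen ys w)) _ ⟩
    indicator y z + count z (unchosen ys w) + count z (chosen ys w)  ≡⟨ ℕP.+-assoc (indicator y z) _ _ ⟩
    indicator y z + (count z (unchosen ys w) + count z (chosen ys w)) ≡⟨ cong (indicator y z +_) (ℕP.+-comm (count z (unchosen ys w)) _) ⟩
    indicator y z + (count z (chosen ys w) + count z (unchosen ys w)) ≡⟨ cong (indicator y z +_) (count-chosen+unchosen z ys w) ⟩
    indicator y z + count z ys                                       ≡⟨ count-∷ y z ys ⟨
    count z (y ∷ ys)                                                 ∎

  count-chosen≤ : ∀ z ys w → count z (chosen ys w) ≤ count z ys
  count-chosen≤ z ys w = subst (count z (chosen ys w) ≤_) (count-chosen+unchosen z ys w) (ℕP.m≤m+n _ _)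

  count-unchosen≤ : ∀ z ys w → count z (unchosen ys w) ≤ count z ys
  count-unchosen≤ z ys w = subst (count z (unchosen ys w) ≤_) (count-chosen+unchosen z ys w) (ℕP.m≤n+m _ _)

  maskOf : (ys : List ℕ) → (ℕ → Bool) → Vec Bool (length ys)
  maskOf []       P = []
  maskOf (y ∷ ys) P = P y ∷ maskOf ys P

  chosen-maskOf-true : ∀ z ys P → P z ≡ true → count z (chosen ys (maskOf ys P)) ≡ count z ys
  chosen-maskOf-true z []       P e = refl
  chosen-maskOf-true z (y ∷ ys) P e with y ≟ z
  ... | yes refl rewrite e = trans (count-∷-≡ y _) (trans (cong suc (chosen-maskOf-true y ys P e)) (sym (count-∷-≡ y ys)))
  ... | no y≢z with P y
  ...   | true  = trans (count-∷-≢ _ y≢z) (trans (chosen-maskOf-true z ys P e) (sym (count-∷-≢ ys y≢z)))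
  ...   | false = trans (chosen-maskOf-true z ys P e) (sym (count-∷-≢ ys y≢z))

  chosen-maskOf-false : ∀ z ys P → P z ≡ false → count z (chosen ys (maskOf ys P)) ≡ 0
  chosen-maskOf-false z []       P e = refl
  chosen-maskOf-false z (y ∷ ys) P e with y ≟ z
  ... | yes refl rewrite e = chosen-maskOf-false y ys P e
  ... | no y≢z with P y
  ...   | true  = trans (count-∷-≢ _ y≢z) (chosen-maskOf-false z ys P e)
  ...   | false = chosen-maskOf-false z ys P e

  unchosen-maskOf-true : ∀ z ys P → P z ≡ true → count z (unchosen ys (maskOf ys P)) ≡ 0
  unchosen-maskOf-true z ys P e = ℕP.+-cancelˡ-≡ (count z ys) _ 0
    (trans (cong (_+ count z (unchosen ys (maskOf ys P))) (sym (chosen-maskOf-true z ys P e)))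
           (trans (count-chosen+unchosen z ys (maskOf ys P)) (sym (ℕP.+-identityʳ _))))

  unchosen-maskOf-false : ∀ z ys P → P z ≡ false → count z (unchosen ys (maskOf ys P)) ≡ count z ys
  unchosen-maskOf-false z ys P e =
    trans (cong (_+ count z (unchosen ys (maskOf ys P))) (sym (chosen-maskOf-false z ys P e)))
          (count-chosen+unchosen z ys (maskOf ys P))

  maskOf-chosen : ∀ ys w L → Distinct ys → (∀ y → y ∈ᵐ ys → count y L ≡ count y (chosen ys w)) →
                  maskOf ys (λ y → y ∈ᵇ L) ≡ w
  maskOf-chosen []       []      L dys h = refl
  maskOf-chosen (y ∷ ys) (t ∷ w) L dys h =
    cong₂ _∷_ (head-bit t (h y (here y ys))) (maskOf-chosen ys w L (distinct-tail y ys dys) tail-counts)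
    where
    y∉ys : count y ys ≡ 0
    y∉ys = distinct-head y ys dys
    head-bit : ∀ t → count y L ≡ count y (chosen (y ∷ ys) (t ∷ w)) → (y ∈ᵇ L) ≡ t
    head-bit true  e = ∈ᵐ⇒∈ᵇ y L (subst (1 ≤_) (sym (trans e (count-∷-≡ y _))) (s≤s z≤n))
    head-bit false e = count≡0⇒∉ᵇ y L (trans e (ℕP.n≤0⇒n≡0 (subst (count y (chosen ys w) ≤_) y∉ys (count-chosen≤ y ys w))))
    chosen-tail : ∀ {z} t → y ≢ z → count z (chosen (y ∷ ys) (t ∷ w)) ≡ count z (chosen ys w)
    chosen-tail true  y≢z = count-∷-≢ _ y≢z
    chosen-tail false y≢z = refl
    tail-counts : ∀ z → z ∈ᵐ ys → count z L ≡ count z (chosen ys w)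
    tail-counts z z∈ = trans (h z (there y ys z∈)) (chosen-tail t y≢z)
      where
      y≢z : y ≢ z
      y≢z refl with () ← subst (1 ≤_) y∉ys z∈

  sumMasks : ℕ → (ℕ → ℕ → ℕ) → ℕ
  sumMasks zero    g = g 0 0
  sumMasks (suc m) g = sumMasks m (λ i j → g (suc i) j) + sumMasks m (λ i j → g i (suc j))

  Σ-mask-∷ : ∀ m (A : Vec Bool (suc m) → Set) →
             Σ (Vec Bool (suc m)) A ↔ (Σ (Vec Bool m) (λ w → A (true ∷ w)) ⊎ Σ (Vec Bool m) (λ w → A (false ∷ w)))
  Σ-mask-∷ m A = mk↔ₛ′ to from to-from from-to
    where
    to : Σ (Vec Bool (suc m)) A → _
    to (true ∷ w , a)  = inj₁ (w , a)
    to (false ∷ w , a) = inj₂ (w , a)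
    from : _ → Σ (Vec Bool (suc m)) A
    from (inj₁ (w , a)) = true ∷ w , a
    from (inj₂ (w , a)) = false ∷ w , a
    to-from : ∀ x → to (from x) ≡ x
    to-from (inj₁ _) = refl
    to-from (inj₂ _) = refl
    from-to : ∀ x → from (to x) ≡ x
    from-to (true ∷ w , a)  = refl
    from-to (false ∷ w , a) = refl

  Σ-mask-[] : ∀ (A : Vec Bool 0 → Set) → Σ (Vec Bool 0) A ↔ A []
  Σ-mask-[] A = mk↔ₛ′ (λ { ([] , a) → a }) (λ a → [] , a) (λ _ → refl) (λ { ([] , a) → refl })

  ⊎↔Fin+ : ∀ {A B : Set} {a b} → A ↔ Fin a → B ↔ Fin b → (A ⊎ B) ↔ Fin (a + b)
  ⊎↔Fin+ f g = ↔-trans (f ⊎-↔ g) (↔-sym FinP.+↔⊎)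

  Σ-mask↔sumMasks : ∀ m (A : Vec Bool m → Set) (g : ℕ → ℕ → ℕ) →
                    (∀ w → A w ↔ Fin (g (trues w) (falses w))) → Σ (Vec Bool m) A ↔ Fin (sumMasks m g)
  Σ-mask↔sumMasks zero    A g h = ↔-trans (Σ-mask-[] A) (h [])
  Σ-mask↔sumMasks (suc m) A g h = ↔-trans (Σ-mask-∷ m A)
    (⊎↔Fin+ (Σ-mask↔sumMasks m (λ w → A (true ∷ w)) (λ i j → g (suc i) j) (λ w → h (true ∷ w)))
            (Σ-mask↔sumMasks m (λ w → A (false ∷ w)) (λ i j → g i (suc j)) (λ w → h (false ∷ w))))

  Increasing : List ℕ → Set
  Increasing xs = T (strictlyIncreasing xs)

  _<head_ : ℕ → List ℕ → Bool
  x <head []      = true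
  x <head (y ∷ _) = x <ᵇ y

  increasing-∷⇔ : ∀ x xs → strictlyIncreasing (x ∷ xs) ≡ (x <head xs) ∧ strictlyIncreasing xs
  increasing-∷⇔ x []      = refl
  increasing-∷⇔ x (y ∷ _) = refl

  increasing-head : ∀ x xs → Increasing (x ∷ xs) → T (x <head xs)
  increasing-head x xs h = ∧-proj₁ (subst T (increasing-∷⇔ x xs) h)

  increasing-tail : ∀ x xs → Increasing (x ∷ xs) → Increasing xs
  increasing-tail x xs h = ∧-proj₂ {x <head xs} (subst T (increasing-∷⇔ x xs) h)

  increasing-∷ : ∀ x xs → T (x <head xs) → Increasing xs → Increasing (x ∷ xs)
  increasing-∷ x xs x<xs inc = subst T (sym (increasing-∷⇔ x xs)) (∧-intro x<xs inc)

  <head-trans : ∀ x y ys → T (x <ᵇ y) → Increasing (y ∷ ys) → T (x <head ys)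
  <head-trans x y []       _   _   = tt
  <head-trans x y (z ∷ ys) x<y inc =
    ℕP.<⇒<ᵇ (ℕP.<-trans (ℕP.<ᵇ⇒< x y x<y) (ℕP.<ᵇ⇒< y z (increasing-head y (z ∷ ys) inc)))

  <ᵇ-false : ∀ {x y} → y < x → (x <ᵇ y) ≡ false
  <ᵇ-false {x} {y} y<x with x <ᵇ y in eq
  ... | false = refl
  ... | true  = ⊥-elim (ℕP.<-asym y<x (ℕP.<ᵇ⇒< x y (≡true⇒T eq)))

  minOf-∷ : ∀ x xs → foldr _⊓_ x xs ≡ x ⊎ foldr _⊓_ x xs ∈ᵐ xs
  minOf-∷ x []       = inj₁ refl
  minOf-∷ x (y ∷ ys) with ℕP.⊓-sel y (foldr _⊓_ x ys) | minOf-∷ x ys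
  ... | inj₁ e | _      = inj₂ (subst (_∈ᵐ (y ∷ ys)) (sym e) (here y ys))
  ... | inj₂ e | inj₁ m = inj₁ (trans e m)
  ... | inj₂ e | inj₂ m = inj₂ (subst (_∈ᵐ (y ∷ ys)) (sym e) (there y ys m))

  leaves-nonempty : ∀ t → T (shapeOK t) → 1 ≤ length (leaves t)
  leaves-nonempty (leaf i)        _ = s≤s z≤n
  leaves-nonempty (node (t ∷ ts)) h = subst (1 ≤_) (sym (ListP.length-++ (leaves t) {leavesL ts}))
    (ℕP.≤-trans (leaves-nonempty t (∧-proj₁ (∧-proj₂ {strictlyIncreasing (map minLeaf (t ∷ ts))}
                                              (∧-proj₂ {2 ℕ.≤ᵇ length (t ∷ ts)} h))))
                (ℕP.m≤m+n _ _))

  minLeaf-∈ : ∀ t → T (shapeOK t) → minLeaf t ∈ᵐ leaves t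
  minLeaf-∈ t sh with leaves t | leaves-nonempty t sh
  ... | x ∷ xs | _ with minOf-∷ x xs
  ...   | inj₁ e = subst (_∈ᵐ (x ∷ xs)) (sym e) (here x xs)
  ...   | inj₂ m = there x xs m

  minLeaves-∌ : ∀ x rs → T (shapeOKL rs) → (∀ z → z ∈ᵐ leavesL rs → x ≢ z) → count x (map minLeaf rs) ≡ 0
  minLeaves-∌ x []       _  _ = refl
  minLeaves-∌ x (r ∷ rs) ok h =
    trans (count-∷-≢ (map minLeaf rs) (λ e → h (minLeaf r) (∈ᵐ-++⁺ˡ (leaves r) (leavesL rs) (minLeaf-∈ r (∧-proj₁ ok))) (sym e)))
          (minLeaves-∌ x rs (∧-proj₂ {shapeOK r} ok) (λ z z∈ → h z (∈ᵐ-++⁺ʳ (leaves r) (leavesL rs) z∈)))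

  childWith : ℕ → List RT → RT
  childWith b []       = leaf 0
  childWith b (t ∷ ts) = if b ∈ᵇ leaves t then t else childWith b ts

  siblingsOf : ℕ → List RT → List RT
  siblingsOf b []       = []
  siblingsOf b (t ∷ ts) = if b ∈ᵇ leaves t then ts else t ∷ siblingsOf b ts

  insertByMin : RT → List RT → List RT
  insertByMin c []       = c ∷ []
  insertByMin c (t ∷ ts) = if minLeaf c <ᵇ minLeaf t then c ∷ t ∷ ts else t ∷ insertByMin c ts

  depthL≡depth-childWith : ∀ b ts → depthL b ts ≡ depth b (childWith b ts)
  depthL≡depth-childWith b []       = refl
  depthL≡depth-childWith b (t ∷ ts) with b ∈ᵇ leaves t
  ... | true  = refl
  ... | false = depthL≡depth-childWith b ts

  ∈ᵐ-leavesL-tail : ∀ b t ts → b ∈ᵇ leaves t ≡ false → b ∈ᵐ leavesL (t ∷ ts) → b ∈ᵐ leavesL ts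
  ∈ᵐ-leavesL-tail b t ts e =
    subst (1 ≤_) (trans (count-++ b (leaves t) (leavesL ts)) (cong (_+ count b (leavesL ts)) (∉ᵇ⇒count≡0 b (leaves t) e)))

  count-leavesL-childWith : ∀ b z ts → b ∈ᵐ leavesL ts →
    count z (leavesL ts) ≡ count z (leaves (childWith b ts)) + count z (leavesL (siblingsOf b ts))
  count-leavesL-childWith b z (t ∷ ts) b∈ with b ∈ᵇ leaves t in eq
  ... | true  = count-++ z (leaves t) (leavesL ts)
  ... | false = begin
    count z (leavesL (t ∷ ts))                  ≡⟨ count-++ z (leaves t) (leavesL ts) ⟩
    count z (leaves t) + count z (leavesL ts)   ≡⟨ cong (count z (leaves t) +_) (count-leavesL-childWith b z ts (∈ᵐ-leavesL-tail b t ts eq b∈)) ⟩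
    count z (leaves t) + (C + R)                ≡⟨ solve 3 (λ a b c → a :+ (b :+ c) := b :+ (a :+ c)) refl (count z (leaves t)) C R ⟩
    C + (count z (leaves t) + R)                ≡⟨ cong (C +_) (count-++ z (leaves t) (leavesL (siblingsOf b ts))) ⟨
    C + count z (leavesL (t ∷ siblingsOf b ts)) ∎
    where
    C = count z (leaves (childWith b ts))
    R = count z (leavesL (siblingsOf b ts))

  childWith-∋ : ∀ b ts → b ∈ᵐ leavesL ts → b ∈ᵇ leaves (childWith b ts) ≡ true
  childWith-∋ b (t ∷ ts) b∈ with b ∈ᵇ leaves t in eq
  ... | true  = eq
  ... | false = childWith-∋ b ts (∈ᵐ-leavesL-tail b t ts eq b∈)

  shapeOK-childWith : ∀ b ts → T (shapeOKL ts) → T (shapeOK (childWith b ts))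
  shapeOK-childWith b []       _ = tt
  shapeOK-childWith b (t ∷ ts) h with b ∈ᵇ leaves t
  ... | true  = ∧-proj₁ h
  ... | false = shapeOK-childWith b ts (∧-proj₂ {shapeOK t} h)

  shapeOKL-siblingsOf : ∀ b ts → T (shapeOKL ts) → T (shapeOKL (siblingsOf b ts))
  shapeOKL-siblingsOf b []       _ = tt
  shapeOKL-siblingsOf b (t ∷ ts) h with b ∈ᵇ leaves t
  ... | true  = ∧-proj₂ {shapeOK t} h
  ... | false = ∧-intro (∧-proj₁ h) (shapeOKL-siblingsOf b ts (∧-proj₂ {shapeOK t} h))

  length-siblingsOf : ∀ b ts → b ∈ᵐ leavesL ts → suc (length (siblingsOf b ts)) ≡ length ts
  length-siblingsOf b (t ∷ ts) b∈ with b ∈ᵇ leaves t in eq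
  ... | true  = refl
  ... | false = cong suc (length-siblingsOf b ts (∈ᵐ-leavesL-tail b t ts eq b∈))

  <head-siblingsOf : ∀ b x ts → T (x <head map minLeaf ts) → Increasing (map minLeaf ts) →
                     T (x <head map minLeaf (siblingsOf b ts))
  <head-siblingsOf b x []       _    _   = tt
  <head-siblingsOf b x (t ∷ ts) x<ts inc with b ∈ᵇ leaves t
  ... | true  = <head-trans x (minLeaf t) (map minLeaf ts) x<ts inc
  ... | false = x<ts

  increasing-siblingsOf : ∀ b ts → Increasing (map minLeaf ts) → Increasing (map minLeaf (siblingsOf b ts))
  increasing-siblingsOf b []       _   = tt
  increasing-siblingsOf b (t ∷ ts) inc with b ∈ᵇ leaves t
  ... | true  = increasing-tail (minLeaf t) (map minLeaf ts) inc
  ... | false = increasing-∷ (minLeaf t) (map minLeaf (siblingsOf b ts))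
                  (<head-siblingsOf b (minLeaf t) ts (increasing-head (minLeaf t) (map minLeaf ts) inc) inc-ts)
                  (increasing-siblingsOf b ts inc-ts)
    where
    inc-ts = increasing-tail (minLeaf t) (map minLeaf ts) inc

  <minLeaf-childWith : ∀ b x ts → T (x <head map minLeaf ts) → Increasing (map minLeaf ts) → b ∈ᵐ leavesL ts →
                       x < minLeaf (childWith b ts)
  <minLeaf-childWith b x (t ∷ ts) x<ts inc b∈ with b ∈ᵇ leaves t in eq
  ... | true  = ℕP.<ᵇ⇒< x (minLeaf t) x<ts
  ... | false = <minLeaf-childWith b x ts (<head-trans x (minLeaf t) (map minLeaf ts) x<ts inc)
                  (increasing-tail (minLeaf t) (map minLeaf ts) inc) (∈ᵐ-leavesL-tail b t ts eq b∈)

  insertByMin-head : ∀ t ts → Increasing (map minLeaf (t ∷ ts)) → insertByMin t ts ≡ t ∷ ts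
  insertByMin-head t []        _   = refl
  insertByMin-head t (t′ ∷ ts) inc = if-true _ _ (T⇒≡true (increasing-head (minLeaf t) (map minLeaf (t′ ∷ ts)) inc))

  insertByMin-childWith : ∀ b ts → Increasing (map minLeaf ts) → b ∈ᵐ leavesL ts →
                          insertByMin (childWith b ts) (siblingsOf b ts) ≡ ts
  insertByMin-childWith b (t ∷ ts) inc b∈ with b ∈ᵇ leaves t in eq
  ... | true  = insertByMin-head t ts inc
  ... | false = trans (if-false _ _ (<ᵇ-false (<minLeaf-childWith b (minLeaf t) ts t<ts inc-ts b∈ts)))
                      (cong (t ∷_) (insertByMin-childWith b ts inc-ts b∈ts))
    where
    t<ts = increasing-head (minLeaf t) (map minLeaf ts) inc
    inc-ts = increasing-tail (minLeaf t) (map minLeaf ts) inc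
    b∈ts = ∈ᵐ-leavesL-tail b t ts eq b∈

  count-leavesL-insertByMin : ∀ z c rs → count z (leavesL (insertByMin c rs)) ≡ count z (leaves c) + count z (leavesL rs)
  count-leavesL-insertByMin z c []       = count-++ z (leaves c) []
  count-leavesL-insertByMin z c (r ∷ rs) with minLeaf c <ᵇ minLeaf r
  ... | true  = count-++ z (leaves c) (leavesL (r ∷ rs))
  ... | false = begin
    count z (leavesL (r ∷ insertByMin c rs))                   ≡⟨ count-++ z (leaves r) (leavesL (insertByMin c rs)) ⟩
    count z (leaves r) + count z (leavesL (insertByMin c rs))  ≡⟨ cong (count z (leaves r) +_) (count-leavesL-insertByMin z c rs) ⟩
    count z (leaves r) + (C + R)                               ≡⟨ solve 3 (λ a b c → a :+ (b :+ c) := b :+ (a :+ c)) refl (count z (leaves r)) C R ⟩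
    C + (count z (leaves r) + R)                               ≡⟨ cong (C +_) (count-++ z (leaves r) (leavesL rs)) ⟨
    C + count z (leavesL (r ∷ rs))                             ∎
    where
    C = count z (leaves c)
    R = count z (leavesL rs)

  childWith-insertByMin : ∀ b c rs → b ∈ᵇ leaves c ≡ true → count b (leavesL rs) ≡ 0 →
                          childWith b (insertByMin c rs) ≡ c × siblingsOf b (insertByMin c rs) ≡ rs
  childWith-insertByMin b c []       b∈c _ = if-true c _ b∈c , if-true [] _ b∈c
  childWith-insertByMin b c (r ∷ rs) b∈c b∉rs with minLeaf c <ᵇ minLeaf r
  ... | true  = if-true c _ b∈c , if-true (r ∷ rs) _ b∈c
  ... | false = trans (if-false r _ b∉r) (proj₁ ih) , trans (if-false (insertByMin c rs) _ b∉r) (cong (r ∷_) (proj₂ ih))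
    where
    b∉rrs = trans (sym (count-++ b (leaves r) (leavesL rs))) b∉rs
    b∉r : b ∈ᵇ leaves r ≡ false
    b∉r = count≡0⇒∉ᵇ b (leaves r) (ℕP.m+n≡0⇒m≡0 _ b∉rrs)
    ih = childWith-insertByMin b c rs b∈c (ℕP.m+n≡0⇒n≡0 (count b (leaves r)) b∉rrs)

  <head-insertByMin : ∀ x c rs → x < minLeaf c → T (x <head map minLeaf rs) → T (x <head map minLeaf (insertByMin c rs))
  <head-insertByMin x c []       x<c _    = ℕP.<⇒<ᵇ x<c
  <head-insertByMin x c (r ∷ rs) x<c x<rs with minLeaf c <ᵇ minLeaf r
  ... | true  = ℕP.<⇒<ᵇ x<c
  ... | false = x<rs

  increasing-insertByMin : ∀ c rs → Increasing (map minLeaf rs) → count (minLeaf c) (map minLeaf rs) ≡ 0 →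
                           Increasing (map minLeaf (insertByMin c rs))
  increasing-insertByMin c []       _   _     = tt
  increasing-insertByMin c (r ∷ rs) inc c∉rrs with minLeaf c <ᵇ minLeaf r in eq
  ... | true  = increasing-∷ (minLeaf c) (map minLeaf (r ∷ rs)) (≡true⇒T eq) inc
  ... | false = increasing-∷ (minLeaf r) (map minLeaf (insertByMin c rs))
                  (<head-insertByMin (minLeaf r) c rs r<c (increasing-head (minLeaf r) (map minLeaf rs) inc))
                  (increasing-insertByMin c rs (increasing-tail (minLeaf r) (map minLeaf rs) inc)
                                             (ℕP.m+n≡0⇒n≡0 (indicator (minLeaf r) (minLeaf c)) c∉rrs′))
    where
    c∉rrs′ = trans (sym (count-∷ (minLeaf r) (minLeaf c) (map minLeaf rs))) c∉rrs
    r<c : minLeaf r < minLeaf c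
    r<c with ℕP.<-cmp (minLeaf r) (minLeaf c)
    ... | tri< r<c _ _ = r<c
    ... | tri≈ _ r≡c _ with () ← trans (sym (cong (λ b → if b then 1 else 0) (≡⇒≡ᵇ-true r≡c)))
                                       (ℕP.m+n≡0⇒m≡0 _ c∉rrs′)
    ... | tri> _ _ c<r with () ← trans (sym eq) (T⇒≡true (ℕP.<⇒<ᵇ c<r))

  shapeOKL-insertByMin : ∀ c rs → T (shapeOK c) → T (shapeOKL rs) → T (shapeOKL (insertByMin c rs))
  shapeOKL-insertByMin c []       okc _   = ∧-intro okc tt
  shapeOKL-insertByMin c (r ∷ rs) okc okr with minLeaf c <ᵇ minLeaf r
  ... | true  = ∧-intro okc okr
  ... | false = ∧-intro (∧-proj₁ okr) (shapeOKL-insertByMin c rs okc (∧-proj₂ {shapeOK r} okr))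

  length-insertByMin : ∀ c rs → length (insertByMin c rs) ≡ suc (length rs)
  length-insertByMin c []       = refl
  length-insertByMin c (r ∷ rs) with minLeaf c <ᵇ minLeaf r
  ... | true  = refl
  ... | false = cong suc (length-insertByMin c rs)

  -- Decomposition at the child containing a given leaf

  TreeOn : List ℕ → (RT → Bool) → Set
  TreeOn S p = Σ RT (λ t → T (shapeOK t) × T (labelledByᵇ S (leaves t)) × T (p t))

  LeafOn : List ℕ → (RT → Bool) → Set
  LeafOn S p = Σ ℕ (λ i → T (labelledByᵇ S (i ∷ [])) × T (p (leaf i)))

  NodeOn : List ℕ → (RT → Bool) → Set
  NodeOn S p = Σ (List RT) (λ ts → T (shapeOK (node ts)) × T (labelledByᵇ S (leavesL ts)) × T (p (node ts)))

  nonEmpty : List RT → Bool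
  nonEmpty []      = false
  nonEmpty (_ ∷ _) = true

  ForestOn : List ℕ → Set
  ForestOn U = Σ (List RT) (λ rs → T (nonEmpty rs) × Increasing (map minLeaf rs) × T (shapeOKL rs)
                                 × T (labelledByᵇ U (leavesL rs)))

  TreeOn-≡ : ∀ {S p} {x y : TreeOn S p} → proj₁ x ≡ proj₁ y → x ≡ y
  TreeOn-≡ {x = t , a , b , c} {y = .t , a′ , b′ , c′} refl
    rewrite T-irrelevant a a′ | T-irrelevant b b′ | T-irrelevant c c′ = refl

  NodeOn-≡ : ∀ {S p} {x y : NodeOn S p} → proj₁ x ≡ proj₁ y → x ≡ y
  NodeOn-≡ {x = ts , a , b , c} {y = .ts , a′ , b′ , c′} refl
    rewrite T-irrelevant a a′ | T-irrelevant b b′ | T-irrelevant c c′ = refl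

  ForestOn-≡ : ∀ {U} {x y : ForestOn U} → proj₁ x ≡ proj₁ y → x ≡ y
  ForestOn-≡ {x = rs , a , b , c , d} {y = .rs , a′ , b′ , c′ , d′} refl
    rewrite T-irrelevant a a′ | T-irrelevant b b′ | T-irrelevant c c′ | T-irrelevant d d′ = refl

  node-shape : ∀ ts → T (shapeOK (node ts)) → 2 ≤ length ts × Increasing (map minLeaf ts) × T (shapeOKL ts)
  node-shape ts h = ℕP.≤ᵇ⇒≤ 2 (length ts) (∧-proj₁ h) , ∧-proj₁ h′ , ∧-proj₂ {strictlyIncreasing (map minLeaf ts)} h′
    where
    h′ = ∧-proj₂ {2 ℕ.≤ᵇ length ts} h

  nonEmpty-insertByMin : ∀ c rs → T (nonEmpty rs) → T (2 ℕ.≤ᵇ length (insertByMin c rs))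
  nonEmpty-insertByMin c (r ∷ rs) _ = ℕP.≤⇒≤ᵇ (subst (2 ≤_) (sym (length-insertByMin c (r ∷ rs))) (s≤s (s≤s z≤n)))

  nonEmpty-siblingsOf : ∀ b ts → 2 ≤ length ts → b ∈ᵐ leavesL ts → T (nonEmpty (siblingsOf b ts))
  nonEmpty-siblingsOf b ts 2≤ b∈ = nonEmpty-of-length (subst (2 ≤_) (sym (length-siblingsOf b ts b∈)) 2≤)
    where
    nonEmpty-of-length : ∀ {rs} → 2 ≤ suc (length rs) → T (nonEmpty rs)
    nonEmpty-of-length {_ ∷ _} _         = tt
    nonEmpty-of-length {[]}    (s≤s ())

  module Decomposition (b : ℕ) (ys : List ℕ) (dS : Distinct (b ∷ ys))
                       (p q : RT → Bool) (p-node : ∀ ts → p (node ts) ≡ q (childWith b ts)) where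

    S : List ℕ
    S = b ∷ ys

    -- w marks the labels of ys that lie in the child containing b.
    Split : Set
    Split = Σ (Vec Bool (length ys)) (λ w → TreeOn (b ∷ chosen ys w) q × ForestOn (unchosen ys w))

    b∉ys : count b ys ≡ 0
    b∉ys = distinct-head b ys dS

    distinct-chosen : ∀ w → Distinct (b ∷ chosen ys w)
    distinct-chosen w z = ℕP.≤-trans
      (subst₂ _≤_ (sym (count-∷ b z (chosen ys w))) (sym (count-∷ b z ys)) (ℕP.+-monoʳ-≤ (indicator b z) (count-chosen≤ z ys w)))
      (dS z)

    distinct-unchosen : ∀ w → Distinct (unchosen ys w)
    distinct-unchosen w z = ℕP.≤-trans (count-unchosen≤ z ys w) (distinct-tail b ys dS z)

    indicator-b≡0 : ∀ {y} → y ∈ᵐ ys → indicator b y ≡ 0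
    indicator-b≡0 {y} y∈ with b ≟ y
    ... | yes refl with () ← subst (1 ≤_) b∉ys y∈
    ... | no b≢y   = indicator-≢ b≢y

    split-labels : ∀ (Lc Lr : List ℕ) → (∀ z → count z Lc + count z Lr ≡ count z S) → b ∈ᵇ Lc ≡ true → ∀ z →
      count z Lc ≡ count z (b ∷ chosen ys (maskOf ys (λ y → y ∈ᵇ Lc))) ×
      count z Lr ≡ count z (unchosen ys (maskOf ys (λ y → y ∈ᵇ Lc)))
    split-labels Lc Lr sum-S b∈ᵇLc z with z ∈ᵇ Lc in z∈ᵇLc
    ... | true = chosen-count , trans r≡0 (sym (unchosen-maskOf-true z ys _ z∈ᵇLc))
      where
      r≡0 : count z Lr ≡ 0
      r≡0 = ℕP.n≤0⇒n≡0 (ℕP.≤-pred (ℕP.≤-trans (ℕP.+-monoˡ-≤ (count z Lr) (∈ᵇ⇒∈ᵐ z Lc z∈ᵇLc))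
                                              (subst (_≤ 1) (sym (sum-S z)) (dS z))))
      chosen-count : count z Lc ≡ count z (b ∷ chosen ys _)
      chosen-count = begin
        count z Lc                                  ≡⟨ ℕP.+-identityʳ _ ⟨
        count z Lc + 0                              ≡⟨ cong (count z Lc +_) r≡0 ⟨
        count z Lc + count z Lr                     ≡⟨ sum-S z ⟩
        count z S                                   ≡⟨ count-∷ b z ys ⟩
        indicator b z + count z ys                  ≡⟨ cong (indicator b z +_) (chosen-maskOf-true z ys _ z∈ᵇLc) ⟨
        indicator b z + count z (chosen ys _)       ≡⟨ count-∷ b z _ ⟨
        count z (b ∷ chosen ys _)                   ∎
    ... | false = trans Lc≡0 (sym (trans (count-∷ b z _) (cong₂ _+_ b≢z (chosen-maskOf-false z ys _ z∈ᵇLc)))) , unchosen-count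
      where
      Lc≡0 : count z Lc ≡ 0
      Lc≡0 = ∉ᵇ⇒count≡0 z Lc z∈ᵇLc
      b≢z : indicator b z ≡ 0
      b≢z with b ≟ z
      ... | yes refl with () ← trans (sym b∈ᵇLc) z∈ᵇLc
      ... | no b≢z   = indicator-≢ b≢z
      unchosen-count : count z Lr ≡ count z (unchosen ys _)
      unchosen-count = begin
        count z Lr                          ≡⟨ cong (_+ count z Lr) Lc≡0 ⟨
        count z Lc + count z Lr             ≡⟨ sum-S z ⟩
        count z S                           ≡⟨ count-∷ b z ys ⟩
        indicator b z + count z ys          ≡⟨ cong (_+ count z ys) b≢z ⟩
        count z ys                          ≡⟨ unchosen-maskOf-false z ys _ z∈ᵇLc ⟨
        count z (unchosen ys _)             ∎

    b∈node : ∀ ts → T (labelledByᵇ S (leavesL ts)) → b ∈ᵐ leavesL ts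
    b∈node ts lab = subst (1 ≤_) (sym (labelledByᵇ⇒≈ᵐ S (leavesL ts) dS lab b)) (here b ys)

    b∈child : ∀ w c → T (labelledByᵇ (b ∷ chosen ys w) (leaves c)) → b ∈ᵇ leaves c ≡ true
    b∈child w c lab =
      ∈ᵐ⇒∈ᵇ b (leaves c) (subst (1 ≤_) (sym (labelledByᵇ⇒≈ᵐ (b ∷ chosen ys w) (leaves c) (distinct-chosen w) lab b)) (here b (chosen ys w)))

    b∉forest : ∀ w rs → T (labelledByᵇ (unchosen ys w) (leavesL rs)) → count b (leavesL rs) ≡ 0
    b∉forest w rs lab = trans (labelledByᵇ⇒≈ᵐ (unchosen ys w) (leavesL rs) (distinct-unchosen w) lab b)
                              (ℕP.n≤0⇒n≡0 (subst (count b (unchosen ys w) ≤_) b∉ys (count-unchosen≤ b ys w)))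

    to : NodeOn S p → Split
    to (ts , sh , lab , p-ts) = w , (c , c-shape , c-lab , c-q) , (rs , rs-ok)
      where
      shape = node-shape ts sh
      b∈ = b∈node ts lab
      c = childWith b ts
      rs = siblingsOf b ts
      w = maskOf ys (λ y → y ∈ᵇ leaves c)
      sum-S : ∀ z → count z (leaves c) + count z (leavesL rs) ≡ count z S
      sum-S z = trans (sym (count-leavesL-childWith b z ts b∈)) (labelledByᵇ⇒≈ᵐ S (leavesL ts) dS lab z)
      labels = split-labels (leaves c) (leavesL rs) sum-S (childWith-∋ b ts b∈)
      c-shape = shapeOK-childWith b ts (proj₂ (proj₂ shape))
      c-lab = ≈ᵐ⇒labelledByᵇ (b ∷ chosen ys w) (leaves c) (distinct-chosen w) (λ z → proj₁ (labels z))
      c-q = subst T (p-node ts) p-ts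
      rs-ok = nonEmpty-siblingsOf b ts (proj₁ shape) b∈ , increasing-siblingsOf b ts (proj₁ (proj₂ shape)) ,
              shapeOKL-siblingsOf b ts (proj₂ (proj₂ shape)) ,
              ≈ᵐ⇒labelledByᵇ (unchosen ys w) (leavesL rs) (distinct-unchosen w) (λ z → proj₂ (labels z))

    from : Split → NodeOn S p
    from (w , (c , c-shape , c-lab , c-q) , (rs , rs-nonEmpty , rs-inc , rs-shape , rs-lab)) =
      insertByMin c rs , shape , lab , p-ins
      where
      sum-S : ∀ z → count z (leaves c) + count z (leavesL rs) ≡ count z S
      sum-S z = begin
        count z (leaves c) + count z (leavesL rs)
          ≡⟨ cong₂ _+_ (labelledByᵇ⇒≈ᵐ (b ∷ chosen ys w) (leaves c) (distinct-chosen w) c-lab z)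
                       (labelledByᵇ⇒≈ᵐ (unchosen ys w) (leavesL rs) (distinct-unchosen w) rs-lab z) ⟩
        count z (b ∷ chosen ys w) + count z (unchosen ys w)
          ≡⟨ cong (_+ count z (unchosen ys w)) (count-∷ b z (chosen ys w)) ⟩
        indicator b z + count z (chosen ys w) + count z (unchosen ys w)
          ≡⟨ ℕP.+-assoc (indicator b z) _ _ ⟩
        indicator b z + (count z (chosen ys w) + count z (unchosen ys w))
          ≡⟨ cong (indicator b z +_) (count-chosen+unchosen z ys w) ⟩
        indicator b z + count z ys
          ≡⟨ count-∷ b z ys ⟨
        count z S
          ∎
      disjoint : ∀ z → z ∈ᵐ leaves c → z ∈ᵐ leavesL rs → ⊥
      disjoint z z∈c z∈rs with s≤s () ← ℕP.≤-trans (ℕP.+-mono-≤ z∈c z∈rs) (subst (_≤ 1) (sym (sum-S z)) (dS z))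
      minLeaf-c∉rs : count (minLeaf c) (map minLeaf rs) ≡ 0
      minLeaf-c∉rs = minLeaves-∌ (minLeaf c) rs rs-shape
                       (λ z z∈ e → disjoint z (subst (_∈ᵐ leaves c) e (minLeaf-∈ c c-shape)) z∈)
      shape = ∧-intro (nonEmpty-insertByMin c rs rs-nonEmpty)
                (∧-intro (increasing-insertByMin c rs rs-inc minLeaf-c∉rs) (shapeOKL-insertByMin c rs c-shape rs-shape))
      lab = ≈ᵐ⇒labelledByᵇ S (leavesL (insertByMin c rs)) dS (λ z → trans (count-leavesL-insertByMin z c rs) (sum-S z))
      p-ins = subst T (sym (trans (p-node (insertByMin c rs))
                (cong q (proj₁ (childWith-insertByMin b c rs (b∈child w c c-lab) (b∉forest w rs rs-lab)))))) c-q

    Split-≡ : ∀ {w w′ c c′ rs rs′ c-ok c-ok′ rs-ok rs-ok′} → w′ ≡ w → c′ ≡ c → rs′ ≡ rs →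
              _≡_ {A = Split} (w′ , (c′ , c-ok′) , (rs′ , rs-ok′)) (w , (c , c-ok) , (rs , rs-ok))
    Split-≡ {w} refl refl refl = cong₂ (λ x y → w , x , y) (TreeOn-≡ {b ∷ chosen ys w} {q} refl) (ForestOn-≡ {unchosen ys w} refl)

    to-from : ∀ x → to (from x) ≡ x
    to-from (w , (c , c-shape , c-lab , c-q) , (rs , rs-nonEmpty , rs-inc , rs-shape , rs-lab)) =
      Split-≡ mask (proj₁ inverse) (proj₂ inverse)
      where
      inverse = childWith-insertByMin b c rs (b∈child w c c-lab) (b∉forest w rs rs-lab)
      mask : maskOf ys (λ y → y ∈ᵇ leaves (childWith b (insertByMin c rs))) ≡ w
      mask = trans (cong (λ c′ → maskOf ys (λ y → y ∈ᵇ leaves c′)) (proj₁ inverse))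
                   (maskOf-chosen ys w (leaves c) (distinct-tail b ys dS) chosen-labels)
        where
        chosen-labels : ∀ y → y ∈ᵐ ys → count y (leaves c) ≡ count y (chosen ys w)
        chosen-labels y y∈ = trans (labelledByᵇ⇒≈ᵐ (b ∷ chosen ys w) (leaves c) (distinct-chosen w) c-lab y)
                                   (trans (count-∷ b y (chosen ys w)) (cong (_+ count y (chosen ys w)) (indicator-b≡0 y∈)))

    from-to : ∀ x → from (to x) ≡ x
    from-to (ts , sh , lab , p-ts) = NodeOn-≡ {S} {p} (insertByMin-childWith b ts (proj₁ (proj₂ (node-shape ts sh))) (b∈node ts lab))

    decomposition : NodeOn S p ↔ Split
    decomposition = mk↔ₛ′ to from to-from from-to

  -- Counting by strong induction on the number of labels

  δ : ℕ → ℕ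
  δ zero    = 1
  δ (suc n) = 0

  _⊛_ : (ℕ → ℕ) → (ℕ → ℕ) → ℕ → ℕ
  (a ⊛ c) m = sumMasks m (λ i j → a i * c j)

  anyTree : RT → Bool
  anyTree _ = true

  ↔Fin0 : ∀ {A : Set} → ¬ A → A ↔ Fin 0
  ↔Fin0 ¬a = mk↔ₛ′ (λ a → ⊥-elim (¬a a)) (λ ()) (λ ()) (λ a → ⊥-elim (¬a a))

  TreeOn-split : ∀ S p → TreeOn S p ↔ (LeafOn S p ⊎ NodeOn S p)
  TreeOn-split S p = mk↔ₛ′ to from to-from from-to
    where
    to : TreeOn S p → LeafOn S p ⊎ NodeOn S p
    to (leaf i  , _ , lab , p-t) = inj₁ (i , lab , p-t)
    to (node ts , h)             = inj₂ (ts , h)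
    from : LeafOn S p ⊎ NodeOn S p → TreeOn S p
    from (inj₁ (i , h))  = leaf i , tt , h
    from (inj₂ (ts , h)) = node ts , h
    to-from : ∀ x → to (from x) ≡ x
    to-from (inj₁ _) = refl
    to-from (inj₂ _) = refl
    from-to : ∀ x → from (to x) ≡ x
    from-to (leaf i  , _) = refl
    from-to (node ts , _) = refl

  LeafOn-count : ∀ b ys p → p (leaf b) ≡ true → LeafOn (b ∷ ys) p ↔ Fin (δ (length ys))
  LeafOn-count b [] p p-leaf = mk↔ₛ′ (λ _ → Fin.zero) (λ _ → b , lab , ≡true⇒T p-leaf) (λ { Fin.zero → refl ; (Fin.suc ()) }) from-to
    where
    distinct-b : Distinct (b ∷ [])
    distinct-b = distinct-∷ b [] (λ _ → z≤n) refl
    lab : T (labelledByᵇ (b ∷ []) (b ∷ []))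
    lab = ≈ᵐ⇒labelledByᵇ (b ∷ []) (b ∷ []) distinct-b (λ _ → refl)
    from-to : ∀ x → (b , lab , ≡true⇒T p-leaf) ≡ x
    from-to (i , lab′ , p′) with i ≟ b
    ... | yes refl = cong (b ,_) (cong₂ _,_ (T-irrelevant lab lab′) (T-irrelevant _ p′))
    ... | no i≢b with () ← trans (sym (count-∷-≢ [] i≢b))
                             (trans (labelledByᵇ⇒≈ᵐ (b ∷ []) (i ∷ []) distinct-b lab′ b) (count-∷-≡ b []))
  LeafOn-count b (y ∷ ys) p _ = ↔Fin0 λ (i , lab , _) → one≢ (labelledByᵇ⇒length (b ∷ y ∷ ys) (i ∷ []) lab)
    where
    one≢ : 1 ≢ suc (suc (length ys))
    one≢ ()

  LeafOn-none : ∀ S p → (∀ i → p (leaf i) ≡ false) → LeafOn S p ↔ Fin 0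
  LeafOn-none S p p-leaf = ↔Fin0 λ (i , _ , p-i) → subst T (p-leaf i) p-i

  ForestOn-split : ∀ U → ForestOn U ↔ (TreeOn U anyTree ⊎ NodeOn U anyTree)
  ForestOn-split U = mk↔ₛ′ to from to-from from-to
    where
    to : ForestOn U → TreeOn U anyTree ⊎ NodeOn U anyTree
    to (r ∷ []           , _ , _   , ok , lab) =
      inj₁ (r , ∧-proj₁ ok , subst (λ xs → T (labelledByᵇ U xs)) (ListP.++-identityʳ (leaves r)) lab , tt)
    to (r ∷ r′ ∷ rs      , _ , inc , ok , lab) = inj₂ (r ∷ r′ ∷ rs , ∧-intro tt (∧-intro inc ok) , lab , tt)
    from : TreeOn U anyTree ⊎ NodeOn U anyTree → ForestOn U
    from (inj₁ (r , ok , lab , _)) =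
      r ∷ [] , tt , tt , ∧-intro ok tt , subst (λ xs → T (labelledByᵇ U xs)) (sym (ListP.++-identityʳ (leaves r))) lab
    from (inj₂ (r ∷ r′ ∷ rs , sh , lab , _)) = r ∷ r′ ∷ rs , tt , proj₁ (proj₂ shape) , proj₂ (proj₂ shape) , lab
      where
      shape = node-shape (r ∷ r′ ∷ rs) sh
    to-from : ∀ x → to (from x) ≡ x
    to-from (inj₁ _)              = cong inj₁ (TreeOn-≡ {U} {anyTree} refl)
    to-from (inj₂ (r ∷ r′ ∷ _ , _)) = cong inj₂ (NodeOn-≡ {U} {anyTree} refl)
    from-to : ∀ x → from (to x) ≡ x
    from-to (r ∷ []      , _) = ForestOn-≡ {U} refl
    from-to (r ∷ r′ ∷ rs , _) = ForestOn-≡ {U} refl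

  ForestOn-[] : ¬ ForestOn []
  ForestOn-[] (r ∷ rs , _ , _ , ok , lab) with labelledByᵇ⇒length [] (leavesL (r ∷ rs)) lab
  ... | length≡0 with () ← subst (1 ≤_) (trans (sym (ListP.length-++ (leaves r) {leavesL rs})) length≡0)
                                  (ℕP.≤-trans (leaves-nonempty r (∧-proj₁ ok)) (ℕP.m≤m+n _ _))

  length≡0⇒[] : ∀ (xs : List ℕ) → length xs ≡ 0 → xs ≡ []
  length≡0⇒[] [] _ = refl

  NodeOn-count : (a f : ℕ → ℕ) → f 0 ≡ 0 → ∀ b ys → Distinct (b ∷ ys) →
    ∀ p q → (∀ ts → p (node ts) ≡ q (childWith b ts)) →
    (∀ {k} → k < length ys → ∀ ys′ → Distinct (b ∷ ys′) → length ys′ ≡ k → TreeOn (b ∷ ys′) q ↔ Fin (a k)) →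
    (∀ {j} → 1 ≤ j → j ≤ length ys → ∀ U → Distinct U → length U ≡ j → ForestOn U ↔ Fin (f j)) →
    NodeOn (b ∷ ys) p ↔ Fin ((a ⊛ f) (length ys))
  NodeOn-count a f f0 b ys dS p q p-node trees forests =
    ↔-trans D.decomposition (Σ-mask↔sumMasks (length ys) _ (λ i j → a i * f j) count-per-mask)
    where
    module D = Decomposition b ys dS p q p-node
    count-per-mask : ∀ w → (TreeOn (b ∷ chosen ys w) q × ForestOn (unchosen ys w)) ↔ Fin (a (trues w) * f (falses w))
    count-per-mask w with zero⊎positive (falses w)
    ... | inj₁ none = subst (λ k → (TreeOn (b ∷ chosen ys w) q × ForestOn (unchosen ys w)) ↔ Fin k) no-pairs
                        (↔Fin0 (λ (_ , forest) → ForestOn-[] (subst ForestOn unchosen≡[] forest)))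
      where
      unchosen≡[] : unchosen ys w ≡ []
      unchosen≡[] = length≡0⇒[] (unchosen ys w) (trans (length-unchosen ys w) none)
      no-pairs : 0 ≡ a (trues w) * f (falses w)
      no-pairs = sym (trans (cong (λ j → a (trues w) * f j) none) (trans (cong (a (trues w) *_) f0) (ℕP.*-zeroʳ (a (trues w)))))
    ... | inj₂ some = ↔-trans (trees chosen<ys (chosen ys w) (D.distinct-chosen w) (length-chosen ys w)
                               ×-↔ forests some unchosen≤ys (unchosen ys w) (D.distinct-unchosen w) (length-unchosen ys w))
                              (↔-sym (FinP.*↔× {a (trues w)} {f (falses w)}))
      where
      chosen<ys : trues w < length ys
      chosen<ys = subst (trues w <_) (trues+falses w)
                    (subst (_≤ trues w + falses w) (ℕP.+-comm (trues w) 1) (ℕP.+-monoʳ-≤ (trues w) some))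
      unchosen≤ys : falses w ≤ length ys
      unchosen≤ys = subst (falses w ≤_) (trues+falses w) (ℕP.m≤n+m _ _)

  labelledBy≡labelledByᵇ : ∀ n t → labelledBy n t ≡ labelledByᵇ (upTo n) (leaves t)
  labelledBy≡labelledByᵇ n t =
    cong (λ k → (length (leaves t) ≡ᵇ k) ∧ all (λ i → count i (leaves t) ≡ᵇ 1) (upTo n)) (sym (ListP.length-upTo n))

  validTree↔TreeOn : ∀ m p → Σ RT (λ t → T (validTree (suc m) t ∧ p t)) ↔ TreeOn (m ∷ upTo m) p
  validTree↔TreeOn m p = mk↔ₛ′ to from (λ _ → TreeOn-≡ {m ∷ upTo m} {p} refl) (λ (t , _) → cong (t ,_) (T-irrelevant _ _))
    where
    to : Σ RT (λ t → T (validTree (suc m) t ∧ p t)) → TreeOn (m ∷ upTo m) p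
    to (t , h) = t , ∧-proj₁ (∧-proj₁ h) ,
      ≈ᵐ-labelledByᵇ (upTo (suc m)) (m ∷ upTo m) (leaves t) (distinct-upTo (suc m)) (distinct-∷-upTo m)
        (λ z → sym (∷-upTo≈upTo-suc m z))
        (subst T (labelledBy≡labelledByᵇ (suc m) t) (∧-proj₂ {shapeOK t} (∧-proj₁ h))) ,
      ∧-proj₂ {validTree (suc m) t} h
    from : TreeOn (m ∷ upTo m) p → Σ RT (λ t → T (validTree (suc m) t ∧ p t))
    from (t , sh , lab , p-t) = t , ∧-intro (∧-intro sh
      (subst T (sym (labelledBy≡labelledByᵇ (suc m) t))
        (≈ᵐ-labelledByᵇ (m ∷ upTo m) (upTo (suc m)) (leaves t) (distinct-∷-upTo m) (distinct-upTo (suc m)) (∷-upTo≈upTo-suc m) lab)))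
      p-t

  Tree↔TreeOn : ∀ m → Tree (suc m) ↔ TreeOn (m ∷ upTo m) anyTree
  Tree↔TreeOn m = ↔-trans (mk↔ₛ′ (λ (t , h) → t , ∧-intro h tt) (λ (t , h) → t , ∧-proj₁ h)
                                  (λ (t , _) → cong (t ,_) (T-irrelevant _ _)) (λ (t , _) → cong (t ,_) (T-irrelevant _ _)))
                          (validTree↔TreeOn m anyTree)

  module TreeCounts (ℓ : ℕ → ℕ) (ℓ-count : ∀ m → Tree (suc m) ↔ Fin (ℓ (suc m))) where

    -- A forest on j ≥ 1 labels is a single tree or the list of children of a node, and the nodes
    -- on n + 1 labels are all trees except the single leaf when n = 0.
    forests : ℕ → ℕ
    forests zero    = 0
    forests (suc n) = ℓ (suc n) + (ℓ (suc n) ∸ δ n)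

    -- Stated for every distinct label list, as subtrees carry arbitrary label sets.
    Counts : ℕ → Set
    Counts n = (∀ b ys → Distinct (b ∷ ys) → length ys ≡ n → TreeOn (b ∷ ys) anyTree ↔ Fin (ℓ (suc n)))
             × (∀ b ys → Distinct (b ∷ ys) → length ys ≡ n → NodeOn (b ∷ ys) anyTree ↔ Fin (ℓ (suc n) ∸ δ n))
             × ℓ (suc n) ≡ δ n + ((λ i → ℓ (suc i)) ⊛ forests) n

    forests-below : ∀ n → (∀ {k} → k < n → Counts k) →
                    ∀ {j} → 1 ≤ j → j ≤ n → ∀ U → Distinct U → length U ≡ j → ForestOn U ↔ Fin (forests j)
    forests-below n IH {suc k} _ k<n (b ∷ ys) dU refl =
      ↔-trans (ForestOn-split (b ∷ ys)) (⊎↔Fin+ (proj₁ (IH k<n) b ys dU refl) (proj₁ (proj₂ (IH k<n)) b ys dU refl))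

    counts-step : ∀ n → (∀ {k} → k < n → Counts k) → Counts n
    counts-step n IH = trees , nodes , recurrence
      where
      K = ((λ i → ℓ (suc i)) ⊛ forests) n
      nodeCount : ∀ b ys → Distinct (b ∷ ys) → length ys ≡ n → NodeOn (b ∷ ys) anyTree ↔ Fin K
      nodeCount b ys dS refl = NodeOn-count (λ i → ℓ (suc i)) forests refl b ys dS anyTree anyTree (λ _ → refl)
        (λ k<n ys′ dS′ len → proj₁ (IH k<n) b ys′ dS′ len) (forests-below n IH)
      treeCount : ∀ b ys → Distinct (b ∷ ys) → length ys ≡ n → TreeOn (b ∷ ys) anyTree ↔ Fin (δ n + K)
      treeCount b ys dS len = ↔-trans (TreeOn-split (b ∷ ys) anyTree)
        (⊎↔Fin+ (subst (λ k → LeafOn (b ∷ ys) anyTree ↔ Fin (δ k)) len (LeafOn-count b ys anyTree refl)) (nodeCount b ys dS len))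
      recurrence : ℓ (suc n) ≡ δ n + K
      recurrence = ↔⇒≡ (↔-trans (↔-sym (ℓ-count n))
                         (↔-trans (Tree↔TreeOn n) (treeCount n (upTo n) (distinct-∷-upTo n) (ListP.length-upTo n))))
      trees : ∀ b ys → Distinct (b ∷ ys) → length ys ≡ n → TreeOn (b ∷ ys) anyTree ↔ Fin (ℓ (suc n))
      trees b ys dS len = subst (λ k → TreeOn (b ∷ ys) anyTree ↔ Fin k) (sym recurrence) (treeCount b ys dS len)
      nodes : ∀ b ys → Distinct (b ∷ ys) → length ys ≡ n → NodeOn (b ∷ ys) anyTree ↔ Fin (ℓ (suc n) ∸ δ n)
      nodes b ys dS len = subst (λ k → NodeOn (b ∷ ys) anyTree ↔ Fin k)
        (sym (trans (cong (_∸ δ n) recurrence) (ℕP.m+n∸m≡n (δ n) K))) (nodeCount b ys dS len)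

    counts : ∀ n → Counts n
    counts = <-rec Counts counts-step

    forest-count : ∀ {j} → 1 ≤ j → ∀ U → Distinct U → length U ≡ j → ForestOn U ↔ Fin (forests j)
    forest-count {j} 1≤j = forests-below j (λ {k} _ → counts k) 1≤j ℕP.≤-refl

    forests-suc : ∀ m → forests (suc m) ≡ ℓ (suc m) + ((λ i → ℓ (suc i)) ⊛ forests) m
    forests-suc m = cong (ℓ (suc m) +_) (trans (cong (_∸ δ m) (proj₂ (proj₂ (counts m)))) (ℕP.m+n∸m≡n (δ m) _))

  evenDepth oddDepth : ℕ → RT → Bool
  evenDepth b t = isEven (depth b t)
  oddDepth  b t = if isEven (depth b t) then false else true

  isEven-suc : ∀ d → isEven (suc d) ≡ (if isEven d then false else true)
  isEven-suc zero          = refl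
  isEven-suc (suc zero)    = refl
  isEven-suc (suc (suc d)) = isEven-suc d

  if-not-not : ∀ x → (if (if x then false else true) then false else true) ≡ x
  if-not-not true  = refl
  if-not-not false = refl

  evenDepth-node : ∀ b ts → evenDepth b (node ts) ≡ oddDepth b (childWith b ts)
  evenDepth-node b ts = trans (isEven-suc (depthL b ts))
    (cong (λ d → if isEven d then false else true) (depthL≡depth-childWith b ts))

  oddDepth-node : ∀ b ts → oddDepth b (node ts) ≡ evenDepth b (childWith b ts)
  oddDepth-node b ts = trans (cong (λ x → if x then false else true) (isEven-suc (depthL b ts)))
    (trans (if-not-not (isEven (depthL b ts))) (cong isEven (depthL≡depth-childWith b ts)))

  module ParityCounts (ℓ e o : ℕ → ℕ) (ℓ-count : ∀ m → Tree (suc m) ↔ Fin (ℓ (suc m)))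
                      (e-count : ∀ m → EvenTree m ↔ Fin (e m)) (o-count : ∀ m → OddTree m ↔ Fin (o m)) where

    open TreeCounts ℓ ℓ-count using (forests; forest-count)

    Counts : ℕ → Set
    Counts n = (∀ b ys → Distinct (b ∷ ys) → length ys ≡ n → TreeOn (b ∷ ys) (evenDepth b) ↔ Fin (e n))
             × (∀ b ys → Distinct (b ∷ ys) → length ys ≡ n → TreeOn (b ∷ ys) (oddDepth b) ↔ Fin (o n))
             × e n ≡ δ n + (o ⊛ forests) n
             × o n ≡ (e ⊛ forests) n

    counts-step : ∀ n → (∀ {k} → k < n → Counts k) → Counts n
    counts-step n IH = evens , odds , even-recurrence , odd-recurrence
      where
      evenCount : ∀ b ys → Distinct (b ∷ ys) → length ys ≡ n → TreeOn (b ∷ ys) (evenDepth b) ↔ Fin (δ n + (o ⊛ forests) n)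
      evenCount b ys dS refl = ↔-trans (TreeOn-split (b ∷ ys) (evenDepth b))
        (⊎↔Fin+ (LeafOn-count b ys (evenDepth b) refl)
                (NodeOn-count o forests refl b ys dS (evenDepth b) (oddDepth b) (evenDepth-node b)
                  (λ k<n ys′ dS′ len → proj₁ (proj₂ (IH k<n)) b ys′ dS′ len) (λ 1≤j _ → forest-count 1≤j)))
      oddCount : ∀ b ys → Distinct (b ∷ ys) → length ys ≡ n → TreeOn (b ∷ ys) (oddDepth b) ↔ Fin (0 + (e ⊛ forests) n)
      oddCount b ys dS refl = ↔-trans (TreeOn-split (b ∷ ys) (oddDepth b))
        (⊎↔Fin+ (LeafOn-none (b ∷ ys) (oddDepth b) (λ _ → refl))
                (NodeOn-count e forests refl b ys dS (oddDepth b) (evenDepth b) (oddDepth-node b)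
                  (λ k<n ys′ dS′ len → proj₁ (IH k<n) b ys′ dS′ len) (λ 1≤j _ → forest-count 1≤j)))
      even-recurrence : e n ≡ δ n + (o ⊛ forests) n
      even-recurrence = ↔⇒≡ (↔-trans (↔-sym (e-count n))
        (↔-trans (validTree↔TreeOn n (evenDepth n)) (evenCount n (upTo n) (distinct-∷-upTo n) (ListP.length-upTo n))))
      odd-recurrence : o n ≡ (e ⊛ forests) n
      odd-recurrence = ↔⇒≡ (↔-trans (↔-sym (o-count n))
        (↔-trans (validTree↔TreeOn n (oddDepth n)) (oddCount n (upTo n) (distinct-∷-upTo n) (ListP.length-upTo n))))
      evens : ∀ b ys → Distinct (b ∷ ys) → length ys ≡ n → TreeOn (b ∷ ys) (evenDepth b) ↔ Fin (e n)
      evens b ys dS len = subst (λ k → TreeOn (b ∷ ys) (evenDepth b) ↔ Fin k) (sym even-recurrence) (evenCount b ys dS len)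
      odds : ∀ b ys → Distinct (b ∷ ys) → length ys ≡ n → TreeOn (b ∷ ys) (oddDepth b) ↔ Fin (o n)
      odds b ys dS len = subst (λ k → TreeOn (b ∷ ys) (oddDepth b) ↔ Fin k) (sym odd-recurrence) (oddCount b ys dS len)

    counts : ∀ n → Counts n
    counts = <-rec Counts counts-step

    even-recurrence : ∀ m → e m ≡ δ m + (o ⊛ forests) m
    even-recurrence m = proj₁ (proj₂ (proj₂ (counts m)))

    odd-recurrence : ∀ m → o m ≡ (e ⊛ forests) m
    odd-recurrence m = proj₂ (proj₂ (proj₂ (counts m)))

module PowerSeries where

  open Enumeration using (δ; _⊛_)
  open import Data.Nat as ℕ using (ℕ; zero; suc; _!; _∸_; z≤n; s≤s)
  import Data.Nat.Properties as ℕP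
  open import Data.Nat.Properties using (_!≢0)
  open import Data.Integer as ℤ using (+_)
  open import Data.Integer.GCD using (gcd)
  import Data.Integer.Properties as ℤP
  open import Data.Integer.Solver using (module +-*-Solver)
  open import Data.Rational using (ℚ; _/_; 0ℚ; 1ℚ; toℚᵘ; ↥_; ↧_; _+_; _*_; _-_; -_)
  import Data.Rational.Properties as ℚP
  import Data.Rational.Unnormalised as ℚᵘ
  import Data.Rational.Unnormalised.Properties as ℚᵘP
  import Data.Rational.Solver as ℚSolver
  open import Data.List using (map; upTo; applyUpTo)
  import Data.List.Properties as ListP
  open import Data.Sum using (inj₁; inj₂)
  open import Relation.Binary.Bundles using (Setoid)
  open import Relation.Binary.PropositionalEquality
  open +-*-Solver using (solve; _:+_; _:*_; _:=_; con)
  open ℚSolver.+-*-Solver using ()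
    renaming (solve to ℚsolve; _:+_ to _⊕_; _:*_ to _⊗_; _:=_ to _≐_; con to ℚcon; _:-_ to _⊝_; :-_ to ⊝_)
  open ≡-Reasoning

  toℚᵘ-/ : ∀ i n .{{_ : ℕ.NonZero n}} → toℚᵘ (i / n) ℚᵘ.≃ (i ℚᵘ./ n)
  toℚᵘ-/ i n@(suc _) = ℚᵘ.*≡* (begin
    ℚᵘ.↥ (toℚᵘ q) ℤ.* + n   ≡⟨ cong (ℤ._* + n) (ℚP.↥ᵘ-toℚᵘ q) ⟩
    ↥ q ℤ.* + n             ≡⟨ cong (↥ q ℤ.*_) (ℚP.↧-/ i n) ⟨
    ↥ q ℤ.* (↧ q ℤ.* g)     ≡⟨ solve 3 (λ a b c → a :* (b :* c) := (a :* c) :* b) refl (↥ q) (↧ q) g ⟩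
    (↥ q ℤ.* g) ℤ.* ↧ q     ≡⟨ cong₂ ℤ._*_ (ℚP.↥-/ i n) (sym (ℚP.↧ᵘ-toℚᵘ q)) ⟩
    i ℤ.* ℚᵘ.↧ (toℚᵘ q)     ∎)
    where
    q = i / n
    g = gcd i (+ n)

  fromℕ : ℕ → ℚ
  fromℕ n = + n / 1

  toℚᵘ-fromℕ : ∀ n → toℚᵘ (fromℕ n) ℚᵘ.≃ (+ n ℚᵘ./ 1)
  toℚᵘ-fromℕ n = toℚᵘ-/ (+ n) 1

  fromℕ-+ : ∀ a b → fromℕ (a ℕ.+ b) ≡ fromℕ a + fromℕ b
  fromℕ-+ a b = ℚP.toℚᵘ-injective (ℚᵘP.≃-trans (toℚᵘ-fromℕ (a ℕ.+ b)) (ℚᵘP.≃-trans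
    (ℚᵘ.*≡* (solve 2 (λ x y → (x :+ y) :* con (+ 1) := (x :* con (+ 1) :+ y :* con (+ 1)) :* con (+ 1)) refl (+ a) (+ b)))
    (ℚᵘP.≃-sym (ℚᵘP.≃-trans (ℚP.toℚᵘ-homo-+ (fromℕ a) (fromℕ b)) (ℚᵘP.+-cong (toℚᵘ-fromℕ a) (toℚᵘ-fromℕ b))))))

  fromℕ-* : ∀ a b → fromℕ (a ℕ.* b) ≡ fromℕ a * fromℕ b
  fromℕ-* a b = ℚP.toℚᵘ-injective (ℚᵘP.≃-trans (toℚᵘ-fromℕ (a ℕ.* b)) (ℚᵘP.≃-trans
    (ℚᵘ.*≡* (cong (ℤ._* + 1) (ℤP.pos-* a b)))
    (ℚᵘP.≃-sym (ℚᵘP.≃-trans (ℚP.toℚᵘ-homo-* (fromℕ a) (fromℕ b)) (ℚᵘP.*-cong (toℚᵘ-fromℕ a) (toℚᵘ-fromℕ b))))))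

  /-*-fromℕ : ∀ a d .{{_ : ℕ.NonZero d}} → (+ a / d) * fromℕ d ≡ fromℕ a
  /-*-fromℕ a d@(suc _) = ℚP.toℚᵘ-injective (ℚᵘP.≃-trans (ℚP.toℚᵘ-homo-* (+ a / d) (fromℕ d))
    (ℚᵘP.≃-trans (ℚᵘP.*-cong (toℚᵘ-/ (+ a) d) (toℚᵘ-fromℕ d))
    (ℚᵘP.≃-trans (ℚᵘ.*≡* (solve 2 (λ x y → (x :* y) :* con (+ 1) := x :* (y :* con (+ 1))) refl (+ a) (+ d)))
    (ℚᵘP.≃-sym (toℚᵘ-fromℕ a)))))

  fromℕ-*-cancelˡ : ∀ d .{{_ : ℕ.NonZero d}} {p q : ℚ} → fromℕ d * p ≡ fromℕ d * q → p ≡ q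
  fromℕ-*-cancelˡ d {p} {q} eq = begin
    p                    ≡⟨ ℚP.*-identityˡ p ⟨
    1ℚ * p               ≡⟨ cong (_* p) (/-*-fromℕ 1 d) ⟨
    (d⁻¹ * fromℕ d) * p  ≡⟨ ℚP.*-assoc d⁻¹ (fromℕ d) p ⟩
    d⁻¹ * (fromℕ d * p)  ≡⟨ cong (d⁻¹ *_) eq ⟩
    d⁻¹ * (fromℕ d * q)  ≡⟨ ℚP.*-assoc d⁻¹ (fromℕ d) q ⟨
    (d⁻¹ * fromℕ d) * q  ≡⟨ cong (_* q) (/-*-fromℕ 1 d) ⟩
    1ℚ * q               ≡⟨ ℚP.*-identityˡ q ⟩
    q                    ∎
    where
    d⁻¹ = + 1 / d

  1/!-suc : ∀ k → 1/! (suc k) * fromℕ (suc k) ≡ 1/! k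
  1/!-suc k = fromℕ-*-cancelˡ (k !) {{k !≢0}} (begin
    fromℕ (k !) * (1/! (suc k) * fromℕ (suc k))  ≡⟨ ℚsolve 3 (λ a b c → a ⊗ (b ⊗ c) ≐ b ⊗ (c ⊗ a)) refl
                                                      (fromℕ (k !)) (1/! (suc k)) (fromℕ (suc k)) ⟩
    1/! (suc k) * (fromℕ (suc k) * fromℕ (k !))  ≡⟨ cong (1/! (suc k) *_) (fromℕ-* (suc k) (k !)) ⟨
    1/! (suc k) * fromℕ (suc k !)                ≡⟨ /-*-fromℕ 1 (suc k !) {{suc k !≢0}} ⟩
    1ℚ                                           ≡⟨ /-*-fromℕ 1 (k !) {{k !≢0}} ⟨
    1/! k * fromℕ (k !)                          ≡⟨ ℚP.*-comm (1/! k) (fromℕ (k !)) ⟩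
    fromℕ (k !) * 1/! k                          ∎)

  ∑ : (ℕ → ℚ) → ℕ → ℚ
  ∑ g zero    = 0ℚ
  ∑ g (suc m) = ∑ g m + g m

  ∑-cong< : ∀ {g h : ℕ → ℚ} m → (∀ k → k ℕ.< m → g k ≡ h k) → ∑ g m ≡ ∑ h m
  ∑-cong< zero    eq = refl
  ∑-cong< (suc m) eq = cong₂ _+_ (∑-cong< m (λ k k<m → eq k (ℕP.m<n⇒m<1+n k<m))) (eq m ℕP.≤-refl)

  ∑-cong : ∀ {g h : ℕ → ℚ} m → (∀ k → g k ≡ h k) → ∑ g m ≡ ∑ h m
  ∑-cong m eq = ∑-cong< m (λ k _ → eq k)

  ∑-suc : ∀ g m → ∑ g (suc m) ≡ g 0 + ∑ (λ k → g (suc k)) m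
  ∑-suc g zero    = ℚP.+-comm 0ℚ (g 0)
  ∑-suc g (suc m) = begin
    ∑ g (suc m) + g (suc m)                     ≡⟨ cong (_+ g (suc m)) (∑-suc g m) ⟩
    (g 0 + ∑ (λ k → g (suc k)) m) + g (suc m)   ≡⟨ ℚP.+-assoc (g 0) _ _ ⟩
    g 0 + ∑ (λ k → g (suc k)) (suc m)           ∎

  ∑-+ : ∀ (g h : ℕ → ℚ) m → ∑ (λ k → g k + h k) m ≡ ∑ g m + ∑ h m
  ∑-+ g h zero    = refl
  ∑-+ g h (suc m) = begin
    ∑ (λ k → g k + h k) m + (g m + h m)  ≡⟨ cong (_+ (g m + h m)) (∑-+ g h m) ⟩
    (∑ g m + ∑ h m) + (g m + h m)        ≡⟨ ℚsolve 4 (λ a b c d → (a ⊕ b) ⊕ (c ⊕ d) ≐ (a ⊕ c) ⊕ (b ⊕ d)) refl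
                                              (∑ g m) (∑ h m) (g m) (h m) ⟩
    (∑ g m + g m) + (∑ h m + h m)        ∎

  ∑-*ˡ : ∀ c (g : ℕ → ℚ) m → c * ∑ g m ≡ ∑ (λ k → c * g k) m
  ∑-*ˡ c g zero    = ℚP.*-zeroʳ c
  ∑-*ˡ c g (suc m) = trans (ℚP.*-distribˡ-+ c (∑ g m) (g m)) (cong (_+ c * g m) (∑-*ˡ c g m))

  ∑-*ʳ : ∀ c (g : ℕ → ℚ) m → ∑ g m * c ≡ ∑ (λ k → g k * c) m
  ∑-*ʳ c g m = trans (ℚP.*-comm (∑ g m) c) (trans (∑-*ˡ c g m) (∑-cong m (λ k → ℚP.*-comm c (g k))))

  ∑-zero : ∀ m → ∑ (λ _ → 0ℚ) m ≡ 0ℚ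
  ∑-zero zero    = refl
  ∑-zero (suc m) = cong (_+ 0ℚ) (∑-zero m)

  ∑-neg : ∀ (g : ℕ → ℚ) m → - ∑ g m ≡ ∑ (λ k → - g k) m
  ∑-neg g zero    = refl
  ∑-neg g (suc m) = trans (ℚP.neg-distrib-+ (∑ g m) (g m)) (cong (_+ - g m) (∑-neg g m))

  ∑-reverse : ∀ (g : ℕ → ℚ) m → ∑ g m ≡ ∑ (λ k → g (m ∸ suc k)) m
  ∑-reverse g zero    = refl
  ∑-reverse g (suc m) = begin
    ∑ g m + g m                              ≡⟨ ℚP.+-comm (∑ g m) (g m) ⟩
    g m + ∑ g m                              ≡⟨ cong (_+_ (g m)) (∑-reverse g m) ⟩
    g m + ∑ (λ k → g (m ∸ suc k)) m          ≡⟨ ∑-suc (λ k → g (suc m ∸ suc k)) m ⟨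
    ∑ (λ k → g (suc m ∸ suc k)) (suc m)      ∎

  ∑-swap : ∀ (h : ℕ → ℕ → ℚ) m p → ∑ (λ i → ∑ (h i) p) m ≡ ∑ (λ k → ∑ (λ i → h i k) m) p
  ∑-swap h zero    p = sym (∑-zero p)
  ∑-swap h (suc m) p = begin
    ∑ (λ i → ∑ (h i) p) m + ∑ (h m) p                  ≡⟨ cong (_+ ∑ (h m) p) (∑-swap h m p) ⟩
    ∑ (λ k → ∑ (λ i → h i k) m) p + ∑ (h m) p          ≡⟨ ∑-+ (λ k → ∑ (λ i → h i k) m) (h m) p ⟨
    ∑ (λ k → ∑ (λ i → h i k) (suc m)) p                ∎

  sumQ-applyUpTo : ∀ (g : ℕ → ℚ) m → sumQ (applyUpTo g m) ≡ ∑ g m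
  sumQ-applyUpTo g zero    = refl
  sumQ-applyUpTo g (suc m) = trans (cong (_+_ (g 0)) (sumQ-applyUpTo (λ k → g (suc k)) m)) (sym (∑-suc g m))

  sumQ-upTo : ∀ (g : ℕ → ℚ) m → sumQ (map g (upTo m)) ≡ ∑ g m
  sumQ-upTo g m = trans (cong sumQ (ListP.map-applyUpTo (λ x → x) g m)) (sumQ-applyUpTo g m)

  -- The ring of formal power series

  infixr 8 _·S_
  _·S_ : ℚ → FPS → FPS
  (c ·S f) n = c * f n

  tailS : FPS → FPS
  tailS f n = f (suc n)

  ≈S-refl : ∀ {f} → f ≈S f
  ≈S-refl n = refl

  ≈S-sym : ∀ {f g} → f ≈S g → g ≈S f
  ≈S-sym e n = sym (e n)

  ≈S-trans : ∀ {f g h} → f ≈S g → g ≈S h → f ≈S h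
  ≈S-trans e e′ n = trans (e n) (e′ n)

  FPS-setoid : Setoid _ _
  FPS-setoid = record
    { Carrier       = FPS
    ; _≈_           = _≈S_
    ; isEquivalence = record
      { refl  = λ {f} → ≈S-refl {f}
      ; sym   = λ {f} {g} → ≈S-sym {f} {g}
      ; trans = λ {f} {g} {h} → ≈S-trans {f} {g} {h}
      }
    }

  *S-coeff : ∀ f g n → (f *S g) n ≡ ∑ (λ k → f k * g (n ∸ k)) (suc n)
  *S-coeff f g n = sumQ-upTo (λ k → f k * g (n ∸ k)) (suc n)

  *S-coeff-zero : ∀ f g → (f *S g) 0 ≡ f 0 * g 0
  *S-coeff-zero f g = trans (*S-coeff f g 0) (ℚP.+-identityˡ _)

  *S-coeff-suc : ∀ f g n → (f *S g) (suc n) ≡ f 0 * g (suc n) + (tailS f *S g) n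
  *S-coeff-suc f g n =
    trans (*S-coeff f g (suc n)) (trans (∑-suc _ (suc n)) (cong (_+_ (f 0 * g (suc n))) (sym (*S-coeff (tailS f) g n))))

  *S-cong : ∀ {f f′ g g′} → f ≈S f′ → g ≈S g′ → (f *S g) ≈S (f′ *S g′)
  *S-cong {f} {f′} {g} {g′} f≈ g≈ n =
    trans (*S-coeff f g n) (trans (∑-cong (suc n) (λ k → cong₂ _*_ (f≈ k) (g≈ (n ∸ k)))) (sym (*S-coeff f′ g′ n)))

  +S-cong : ∀ {f f′ g g′} → f ≈S f′ → g ≈S g′ → (f +S g) ≈S (f′ +S g′)
  +S-cong f≈ g≈ n = cong₂ _+_ (f≈ n) (g≈ n)

  -S-cong : ∀ {f f′ g g′} → f ≈S f′ → g ≈S g′ → (f -S g) ≈S (f′ -S g′)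
  -S-cong f≈ g≈ n = cong₂ _-_ (f≈ n) (g≈ n)

  ·S-cong : ∀ {c f f′} → f ≈S f′ → (c ·S f) ≈S (c ·S f′)
  ·S-cong {c} f≈ n = cong (c *_) (f≈ n)

  *S-comm : ∀ f g → (f *S g) ≈S (g *S f)
  *S-comm f g n = begin
    (f *S g) n                                        ≡⟨ *S-coeff f g n ⟩
    ∑ (λ k → f k * g (n ∸ k)) (suc n)                 ≡⟨ ∑-reverse _ (suc n) ⟩
    ∑ (λ k → f (n ∸ k) * g (n ∸ (n ∸ k))) (suc n)     ≡⟨ ∑-cong< (suc n) (λ k k<1+n → trans (ℚP.*-comm (f (n ∸ k)) _)
                                                           (cong (λ z → g z * f (n ∸ k)) (ℕP.m∸[m∸n]≡n (ℕP.≤-pred k<1+n)))) ⟩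
    ∑ (λ k → g k * f (n ∸ k)) (suc n)                 ≡⟨ *S-coeff g f n ⟨
    (g *S f) n                                        ∎

  *S-distribʳ-+ : ∀ f g h → ((f +S g) *S h) ≈S ((f *S h) +S (g *S h))
  *S-distribʳ-+ f g h n = begin
    ((f +S g) *S h) n                                   ≡⟨ *S-coeff (f +S g) h n ⟩
    ∑ (λ k → (f k + g k) * h (n ∸ k)) (suc n)           ≡⟨ ∑-cong (suc n) (λ k → ℚP.*-distribʳ-+ (h (n ∸ k)) (f k) (g k)) ⟩
    ∑ (λ k → f k * h (n ∸ k) + g k * h (n ∸ k)) (suc n) ≡⟨ ∑-+ _ _ (suc n) ⟩
    ∑ (λ k → f k * h (n ∸ k)) (suc n) + ∑ (λ k → g k * h (n ∸ k)) (suc n)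
                                                        ≡⟨ cong₂ _+_ (*S-coeff f h n) (*S-coeff g h n) ⟨
    ((f *S h) +S (g *S h)) n                            ∎

  *S-distribʳ-- : ∀ f g h → ((f -S g) *S h) ≈S ((f *S h) -S (g *S h))
  *S-distribʳ-- f g h n = begin
    ((f -S g) *S h) n                                        ≡⟨ *S-coeff (f -S g) h n ⟩
    ∑ (λ k → (f k - g k) * h (n ∸ k)) (suc n)                ≡⟨ ∑-cong (suc n) (λ k → ℚsolve 3 (λ a b c → (a ⊝ b) ⊗ c ≐ a ⊗ c ⊕ (⊝ (b ⊗ c)))
                                                                  refl (f k) (g k) (h (n ∸ k))) ⟩
    ∑ (λ k → f k * h (n ∸ k) + - (g k * h (n ∸ k))) (suc n)  ≡⟨ ∑-+ _ _ (suc n) ⟩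
    ∑ (λ k → f k * h (n ∸ k)) (suc n) + ∑ (λ k → - (g k * h (n ∸ k))) (suc n)
                                                             ≡⟨ cong (_+_ (∑ (λ k → f k * h (n ∸ k)) (suc n))) (∑-neg _ (suc n)) ⟨
    ∑ (λ k → f k * h (n ∸ k)) (suc n) - ∑ (λ k → g k * h (n ∸ k)) (suc n)
                                                             ≡⟨ cong₂ _-_ (*S-coeff f h n) (*S-coeff g h n) ⟨
    ((f *S h) -S (g *S h)) n                                 ∎

  *S-distribˡ-+ : ∀ f g h → (h *S (f +S g)) ≈S ((h *S f) +S (h *S g))
  *S-distribˡ-+ f g h = ≈S-trans (*S-comm h (f +S g)) (≈S-trans (*S-distribʳ-+ f g h) (+S-cong (*S-comm f h) (*S-comm g h)))

  *S-distribˡ-- : ∀ f g h → (h *S (f -S g)) ≈S ((h *S f) -S (h *S g))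
  *S-distribˡ-- f g h = ≈S-trans (*S-comm h (f -S g)) (≈S-trans (*S-distribʳ-- f g h) (-S-cong (*S-comm f h) (*S-comm g h)))

  *S-·Sˡ : ∀ c f g → ((c ·S f) *S g) ≈S (c ·S (f *S g))
  *S-·Sˡ c f g n = begin
    ((c ·S f) *S g) n                         ≡⟨ *S-coeff (c ·S f) g n ⟩
    ∑ (λ k → (c * f k) * g (n ∸ k)) (suc n)   ≡⟨ ∑-cong (suc n) (λ k → ℚP.*-assoc c (f k) (g (n ∸ k))) ⟩
    ∑ (λ k → c * (f k * g (n ∸ k))) (suc n)   ≡⟨ ∑-*ˡ c _ (suc n) ⟨
    c * ∑ (λ k → f k * g (n ∸ k)) (suc n)     ≡⟨ cong (c *_) (*S-coeff f g n) ⟨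
    (c ·S (f *S g)) n                         ∎

  *S-·Sʳ : ∀ c f g → (f *S (c ·S g)) ≈S (c ·S (f *S g))
  *S-·Sʳ c f g = ≈S-trans (*S-comm f (c ·S g)) (≈S-trans (*S-·Sˡ c g f) (·S-cong {c} (*S-comm g f)))

  *S-zeroˡ : ∀ f g → (∀ k → f k ≡ 0ℚ) → ∀ n → (f *S g) n ≡ 0ℚ
  *S-zeroˡ f g f≡0 n = trans (*S-coeff f g n)
    (trans (∑-cong (suc n) (λ k → trans (cong (_* g (n ∸ k)) (f≡0 k)) (ℚP.*-zeroˡ (g (n ∸ k))))) (∑-zero (suc n)))

  *S-zeroʳ : ∀ f g → (∀ k → g k ≡ 0ℚ) → ∀ n → (f *S g) n ≡ 0ℚ
  *S-zeroʳ f g g≡0 n = trans (*S-comm f g n) (*S-zeroˡ g f g≡0 n)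

  *S-identityˡ : ∀ f → (oneS *S f) ≈S f
  *S-identityˡ f zero    = trans (*S-coeff-zero oneS f) (ℚP.*-identityˡ (f 0))
  *S-identityˡ f (suc n) = trans (*S-coeff-suc oneS f n)
    (trans (cong₂ _+_ (ℚP.*-identityˡ (f (suc n))) (*S-zeroˡ (tailS oneS) f (λ _ → refl) n)) (ℚP.+-identityʳ _))

  *S-identityʳ : ∀ f → (f *S oneS) ≈S f
  *S-identityʳ f = ≈S-trans (*S-comm f oneS) (*S-identityˡ f)

  *S-assoc : ∀ f g h → ((f *S g) *S h) ≈S (f *S (g *S h))
  *S-assoc f g h zero = begin
    ((f *S g) *S h) 0    ≡⟨ *S-coeff-zero (f *S g) h ⟩
    (f *S g) 0 * h 0     ≡⟨ cong (_* h 0) (*S-coeff-zero f g) ⟩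
    (f 0 * g 0) * h 0    ≡⟨ ℚP.*-assoc (f 0) (g 0) (h 0) ⟩
    f 0 * (g 0 * h 0)    ≡⟨ cong (f 0 *_) (*S-coeff-zero g h) ⟨
    f 0 * (g *S h) 0     ≡⟨ *S-coeff-zero f (g *S h) ⟨
    (f *S (g *S h)) 0    ∎
  *S-assoc f g h (suc n) = begin
    ((f *S g) *S h) (suc n)
      ≡⟨ *S-coeff-suc (f *S g) h n ⟩
    (f *S g) 0 * h (suc n) + (tailS (f *S g) *S h) n
      ≡⟨ cong₂ _+_ (cong (_* h (suc n)) (*S-coeff-zero f g)) (*S-cong {g = h} (*S-coeff-suc f g) ≈S-refl n) ⟩
    (f 0 * g 0) * h (suc n) + (((f 0 ·S tailS g) +S (tailS f *S g)) *S h) n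
      ≡⟨ cong (_+_ ((f 0 * g 0) * h (suc n))) (*S-distribʳ-+ (f 0 ·S tailS g) (tailS f *S g) h n) ⟩
    (f 0 * g 0) * h (suc n) + (((f 0 ·S tailS g) *S h) n + ((tailS f *S g) *S h) n)
      ≡⟨ cong (_+_ ((f 0 * g 0) * h (suc n))) (cong₂ _+_ (*S-·Sˡ (f 0) (tailS g) h n) (*S-assoc (tailS f) g h n)) ⟩
    (f 0 * g 0) * h (suc n) + (f 0 * (tailS g *S h) n + (tailS f *S (g *S h)) n)
      ≡⟨ ℚsolve 5 (λ a b c x y → (a ⊗ b) ⊗ c ⊕ (a ⊗ x ⊕ y) ≐ a ⊗ (b ⊗ c ⊕ x) ⊕ y) refl
                  (f 0) (g 0) (h (suc n)) ((tailS g *S h) n) ((tailS f *S (g *S h)) n) ⟩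
    f 0 * (g 0 * h (suc n) + (tailS g *S h) n) + (tailS f *S (g *S h)) n
      ≡⟨ cong (λ z → f 0 * z + (tailS f *S (g *S h)) n) (*S-coeff-suc g h n) ⟨
    f 0 * (g *S h) (suc n) + (tailS f *S (g *S h)) n
      ≡⟨ *S-coeff-suc f (g *S h) n ⟨
    (f *S (g *S h)) (suc n)
      ∎

  D : FPS → FPS
  D f n = fromℕ (suc n) * f (suc n)

  D-cong : ∀ {f g} → f ≈S g → D f ≈S D g
  D-cong f≈g n = cong (fromℕ (suc n) *_) (f≈g (suc n))

  D-+ : ∀ f g → D (f +S g) ≈S (D f +S D g)
  D-+ f g n = ℚP.*-distribˡ-+ (fromℕ (suc n)) (f (suc n)) (g (suc n))

  D-oneS : ∀ n → D oneS n ≡ 0ℚ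
  D-oneS n = ℚP.*-zeroʳ (fromℕ (suc n))

  -- Split the weight n + 1 of the term f k g (n + 1 - k) as k + (n + 1 - k).
  D-*S : ∀ f g → D (f *S g) ≈S ((D f *S g) +S (f *S D g))
  D-*S f g n = begin
    fromℕ (suc n) * (f *S g) (suc n)             ≡⟨ cong (fromℕ (suc n) *_) (*S-coeff f g (suc n)) ⟩
    fromℕ (suc n) * ∑ term (suc (suc n))         ≡⟨ ∑-*ˡ (fromℕ (suc n)) term (suc (suc n)) ⟩
    ∑ (λ k → fromℕ (suc n) * term k) (suc (suc n)) ≡⟨ ∑-cong< (suc (suc n)) split ⟩
    ∑ (λ k → A k + B k) (suc (suc n))            ≡⟨ ∑-+ A B (suc (suc n)) ⟩
    ∑ A (suc (suc n)) + ∑ B (suc (suc n))        ≡⟨ cong₂ _+_ ∑A ∑B ⟩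
    (D f *S g) n + (f *S D g) n                  ∎
    where
    term A B : ℕ → ℚ
    term k = f k * g (suc n ∸ k)
    A k = fromℕ k * term k
    B k = fromℕ (suc n ∸ k) * term k
    split : ∀ k → k ℕ.< suc (suc n) → fromℕ (suc n) * term k ≡ A k + B k
    split k k<2+n = trans (cong (λ z → fromℕ z * term k) (sym (ℕP.m+[n∸m]≡n (ℕP.≤-pred k<2+n))))
      (trans (cong (_* term k) (fromℕ-+ k (suc n ∸ k))) (ℚP.*-distribʳ-+ (term k) (fromℕ k) (fromℕ (suc n ∸ k))))
    ∑A : ∑ A (suc (suc n)) ≡ (D f *S g) n
    ∑A = begin
      ∑ A (suc (suc n))                    ≡⟨ ∑-suc A (suc n) ⟩
      A 0 + ∑ (λ k → A (suc k)) (suc n)    ≡⟨ cong (_+ ∑ (λ k → A (suc k)) (suc n)) (ℚP.*-zeroˡ (term 0)) ⟩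
      0ℚ + ∑ (λ k → A (suc k)) (suc n)     ≡⟨ ℚP.+-identityˡ _ ⟩
      ∑ (λ k → A (suc k)) (suc n)          ≡⟨ ∑-cong (suc n) (λ k → sym (ℚP.*-assoc (fromℕ (suc k)) (f (suc k)) (g (n ∸ k)))) ⟩
      ∑ (λ k → D f k * g (n ∸ k)) (suc n)  ≡⟨ *S-coeff (D f) g n ⟨
      (D f *S g) n                         ∎
    ∑B : ∑ B (suc (suc n)) ≡ (f *S D g) n
    ∑B = begin
      ∑ B (suc n) + B (suc n)              ≡⟨ cong (_+_ (∑ B (suc n))) (trans (cong (λ z → fromℕ z * term (suc n)) (ℕP.n∸n≡0 n))
                                                                          (ℚP.*-zeroˡ (term (suc n)))) ⟩
      ∑ B (suc n) + 0ℚ                     ≡⟨ ℚP.+-identityʳ _ ⟩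
      ∑ B (suc n)                          ≡⟨ ∑-cong< (suc n) (λ k k<1+n →
                                                trans (cong (λ z → fromℕ z * (f k * g z)) (ℕP.+-∸-assoc 1 (ℕP.≤-pred k<1+n)))
                                                      (ℚsolve 3 (λ a b c → a ⊗ (b ⊗ c) ≐ b ⊗ (a ⊗ c)) refl
                                                              (fromℕ (suc (n ∸ k))) (f k) (g (suc (n ∸ k))))) ⟩
      ∑ (λ k → f k * D g (n ∸ k)) (suc n)  ≡⟨ *S-coeff f (D g) n ⟨
      (f *S D g) n                         ∎

  D-^S : ∀ f k → D (f ^S suc k) ≈S (fromℕ (suc k) ·S ((f ^S k) *S D f))
  D-^S f zero n = begin
    D (f *S oneS) n                          ≡⟨ D-*S f oneS n ⟩
    (D f *S oneS) n + (f *S D oneS) n        ≡⟨ cong₂ _+_ (*S-identityʳ (D f) n) (*S-zeroʳ f (D oneS) D-oneS n) ⟩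
    D f n + 0ℚ                               ≡⟨ ℚP.+-identityʳ _ ⟩
    D f n                                    ≡⟨ *S-identityˡ (D f) n ⟨
    (oneS *S D f) n                          ≡⟨ ℚP.*-identityˡ _ ⟨
    1ℚ * (oneS *S D f) n                     ∎
  D-^S f (suc k) n = begin
    D (f *S (f ^S suc k)) n                                      ≡⟨ D-*S f (f ^S suc k) n ⟩
    (D f *S (f ^S suc k)) n + (f *S D (f ^S suc k)) n            ≡⟨ cong₂ _+_ (*S-comm (D f) (f ^S suc k) n)
                                                                              (*S-cong {f} ≈S-refl (D-^S f k) n) ⟩
    x + (f *S (c ·S ((f ^S k) *S D f))) n                        ≡⟨ cong (_+_ x) (*S-·Sʳ c f ((f ^S k) *S D f) n) ⟩
    x + c * (f *S ((f ^S k) *S D f)) n                           ≡⟨ cong (λ z → x + c * z) (*S-assoc f (f ^S k) (D f) n) ⟨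
    x + c * x                                                    ≡⟨ ℚsolve 2 (λ x c → x ⊕ c ⊗ x ≐ (ℚcon 1ℚ ⊕ c) ⊗ x) refl x c ⟩
    (1ℚ + c) * x                                                 ≡⟨ cong (_* x) (fromℕ-+ 1 (suc k)) ⟨
    fromℕ (suc (suc k)) * x                                      ∎
    where
    c = fromℕ (suc k)
    x = ((f ^S suc k) *S D f) n

  ^S-coeff-low : ∀ f → f 0 ≡ 0ℚ → ∀ k n → n ℕ.< k → (f ^S k) n ≡ 0ℚ
  ^S-coeff-low f f0 (suc k) zero    _         =
    trans (*S-coeff-zero f (f ^S k)) (trans (cong (_* (f ^S k) 0) f0) (ℚP.*-zeroˡ ((f ^S k) 0)))
  ^S-coeff-low f f0 (suc k) (suc n) (s≤s n<k) = begin
    (f *S (f ^S k)) (suc n)                                 ≡⟨ *S-coeff-suc f (f ^S k) n ⟩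
    f 0 * (f ^S k) (suc n) + (tailS f *S (f ^S k)) n        ≡⟨ cong₂ _+_ (trans (cong (_* (f ^S k) (suc n)) f0) (ℚP.*-zeroˡ ((f ^S k) (suc n))))
                                                                         (*S-coeff (tailS f) (f ^S k) n) ⟩
    0ℚ + ∑ (λ j → tailS f j * (f ^S k) (n ∸ j)) (suc n)     ≡⟨ cong (_+_ 0ℚ) (∑-cong< (suc n) (λ j _ →
                                                                 trans (cong (tailS f j *_) (^S-coeff-low f f0 k (n ∸ j)
                                                                                               (ℕP.≤-<-trans (ℕP.m∸n≤m n j) n<k)))
                                                                       (ℚP.*-zeroʳ (tailS f j)))) ⟩
    0ℚ + ∑ (λ _ → 0ℚ) (suc n)                               ≡⟨ cong (_+_ 0ℚ) (∑-zero (suc n)) ⟩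
    0ℚ                                                      ∎

  expPartial : FPS → ℕ → ℕ → ℚ
  expPartial f n N = ∑ (λ k → 1/! k * (f ^S k) n) (suc N)

  expS≡expPartial : ∀ f n → expS f n ≡ expPartial f n n
  expS≡expPartial f n = sumQ-upTo (λ k → 1/! k * (f ^S k) n) (suc n)

  expPartial-extend : ∀ f → f 0 ≡ 0ℚ → ∀ n d → expPartial f n (d ℕ.+ n) ≡ expPartial f n n
  expPartial-extend f f0 n zero    = refl
  expPartial-extend f f0 n (suc d) = begin
    expPartial f n (d ℕ.+ n) + 1/! (suc (d ℕ.+ n)) * (f ^S suc (d ℕ.+ n)) n
      ≡⟨ cong₂ _+_ (expPartial-extend f f0 n d)
                   (trans (cong (1/! (suc (d ℕ.+ n)) *_) (^S-coeff-low f f0 (suc (d ℕ.+ n)) n (s≤s (ℕP.m≤n+m n d))))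
                          (ℚP.*-zeroʳ (1/! (suc (d ℕ.+ n))))) ⟩
    expPartial f n n + 0ℚ
      ≡⟨ ℚP.+-identityʳ _ ⟩
    expPartial f n n
      ∎

  expPartial≡expS : ∀ f → f 0 ≡ 0ℚ → ∀ n N → n ℕ.≤ N → expPartial f n N ≡ expS f n
  expPartial≡expS f f0 n N n≤N = trans (cong (expPartial f n) (sym (ℕP.m∸n+n≡m n≤N)))
    (trans (expPartial-extend f f0 n (N ∸ n)) (sym (expS≡expPartial f n)))

  D-expS : ∀ f → f 0 ≡ 0ℚ → D (expS f) ≈S (D f *S expS f)
  D-expS f f0 n = begin
    fromℕ (suc n) * expS f (suc n)
      ≡⟨ cong (fromℕ (suc n) *_) (expS≡expPartial f (suc n)) ⟩
    fromℕ (suc n) * ∑ (λ k → 1/! k * (f ^S k) (suc n)) (suc (suc n))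
      ≡⟨ ∑-*ˡ (fromℕ (suc n)) _ (suc (suc n)) ⟩
    ∑ (λ k → fromℕ (suc n) * (1/! k * (f ^S k) (suc n))) (suc (suc n))
      ≡⟨ ∑-cong (suc (suc n)) (λ k → ℚsolve 3 (λ a b c → a ⊗ (b ⊗ c) ≐ b ⊗ (a ⊗ c)) refl (fromℕ (suc n)) (1/! k) ((f ^S k) (suc n))) ⟩
    ∑ (λ k → 1/! k * D (f ^S k) n) (suc (suc n))
      ≡⟨ ∑-suc _ (suc n) ⟩
    1/! 0 * D oneS n + ∑ (λ k → 1/! (suc k) * D (f ^S suc k) n) (suc n)
      ≡⟨ cong₂ _+_ (trans (cong (1/! 0 *_) (D-oneS n)) (ℚP.*-zeroʳ (1/! 0))) (∑-cong (suc n) (λ k → cong (1/! (suc k) *_) (D-^S f k n))) ⟩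
    0ℚ + ∑ (λ k → 1/! (suc k) * (fromℕ (suc k) * ((f ^S k) *S D f) n)) (suc n)
      ≡⟨ ℚP.+-identityˡ _ ⟩
    ∑ (λ k → 1/! (suc k) * (fromℕ (suc k) * ((f ^S k) *S D f) n)) (suc n)
      ≡⟨ ∑-cong (suc n) (λ k → trans (sym (ℚP.*-assoc (1/! (suc k)) (fromℕ (suc k)) _)) (cong (_* ((f ^S k) *S D f) n) (1/!-suc k))) ⟩
    ∑ (λ k → 1/! k * ((f ^S k) *S D f) n) (suc n)
      ≡⟨ ∑-cong (suc n) (λ k → trans (cong (1/! k *_) (*S-coeff (f ^S k) (D f) n)) (∑-*ˡ (1/! k) _ (suc n))) ⟩
    ∑ (λ k → ∑ (λ i → 1/! k * ((f ^S k) i * D f (n ∸ i))) (suc n)) (suc n)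
      ≡⟨ ∑-swap (λ i k → 1/! k * ((f ^S k) i * D f (n ∸ i))) (suc n) (suc n) ⟨
    ∑ (λ i → ∑ (λ k → 1/! k * ((f ^S k) i * D f (n ∸ i))) (suc n)) (suc n)
      ≡⟨ ∑-cong (suc n) (λ i → trans (∑-cong (suc n) (λ k → sym (ℚP.*-assoc (1/! k) ((f ^S k) i) (D f (n ∸ i)))))
                                     (sym (∑-*ʳ (D f (n ∸ i)) _ (suc n)))) ⟩
    ∑ (λ i → expPartial f i n * D f (n ∸ i)) (suc n)
      ≡⟨ ∑-cong< (suc n) (λ i i<1+n → cong (_* D f (n ∸ i)) (expPartial≡expS f f0 i n (ℕP.≤-pred i<1+n))) ⟩
    ∑ (λ i → expS f i * D f (n ∸ i)) (suc n)
      ≡⟨ *S-coeff (expS f) (D f) n ⟨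
    (expS f *S D f) n
      ≡⟨ *S-comm (expS f) (D f) n ⟩
    (D f *S expS f) n
      ∎

  linear-ode-unique : ∀ P G H → G 0 ≡ H 0 → D G ≈S (P *S G) → D H ≈S (P *S H) → G ≈S H
  linear-ode-unique P G H G0≡H0 G′ H′ n = agree-below n n ℕP.≤-refl
    where
    agree-below : ∀ n m → m ℕ.≤ n → G m ≡ H m
    agree-below zero    .zero z≤n   = G0≡H0
    agree-below (suc n) m     m≤1+n with ℕP.m≤n⇒m<n∨m≡n m≤1+n
    ... | inj₁ m<1+n = agree-below n m (ℕP.≤-pred m<1+n)
    ... | inj₂ refl  = fromℕ-*-cancelˡ (suc n) (begin
      fromℕ (suc n) * G (suc n)           ≡⟨ G′ n ⟩
      (P *S G) n                          ≡⟨ *S-coeff P G n ⟩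
      ∑ (λ k → P k * G (n ∸ k)) (suc n)   ≡⟨ ∑-cong (suc n) (λ k → cong (P k *_) (agree-below n (n ∸ k) (ℕP.m∸n≤m n k))) ⟩
      ∑ (λ k → P k * H (n ∸ k)) (suc n)   ≡⟨ *S-coeff P H n ⟨
      (P *S H) n                          ≡⟨ H′ n ⟨
      fromℕ (suc n) * H (suc n)           ∎)

  egfShift-coeff : ∀ a n → egfShift a n ≡ fromℕ (a n) * 1/! n
  egfShift-coeff a n = fromℕ-*-cancelˡ (n !) {{n !≢0}} (begin
    fromℕ (n !) * egfShift a n            ≡⟨ ℚP.*-comm (fromℕ (n !)) (egfShift a n) ⟩
    egfShift a n * fromℕ (n !)            ≡⟨ /-*-fromℕ (a n) (n !) {{n !≢0}} ⟩
    fromℕ (a n)                           ≡⟨ ℚP.*-identityʳ (fromℕ (a n)) ⟨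
    fromℕ (a n) * 1ℚ                      ≡⟨ cong (fromℕ (a n) *_) (/-*-fromℕ 1 (n !) {{n !≢0}}) ⟨
    fromℕ (a n) * (1/! n * fromℕ (n !))   ≡⟨ ℚsolve 3 (λ a b c → a ⊗ (b ⊗ c) ≐ c ⊗ (a ⊗ b)) refl (fromℕ (a n)) (1/! n) (fromℕ (n !)) ⟩
    fromℕ (n !) * (fromℕ (a n) * 1/! n)   ∎)

  egfShift-cong : ∀ {a b} → (∀ n → a n ≡ b n) → egfShift a ≈S egfShift b
  egfShift-cong {a} {b} a≡b n = trans (egfShift-coeff a n) (trans (cong (λ z → fromℕ z * 1/! n) (a≡b n)) (sym (egfShift-coeff b n)))

  D-egfShift : ∀ a → D (egfShift a) ≈S egfShift (λ n → a (suc n))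
  D-egfShift a n = begin
    fromℕ (suc n) * egfShift a (suc n)                   ≡⟨ cong (fromℕ (suc n) *_) (egfShift-coeff a (suc n)) ⟩
    fromℕ (suc n) * (fromℕ (a (suc n)) * 1/! (suc n))    ≡⟨ ℚsolve 3 (λ a b c → a ⊗ (b ⊗ c) ≐ b ⊗ (c ⊗ a)) refl
                                                               (fromℕ (suc n)) (fromℕ (a (suc n))) (1/! (suc n)) ⟩
    fromℕ (a (suc n)) * (1/! (suc n) * fromℕ (suc n))    ≡⟨ cong (fromℕ (a (suc n)) *_) (1/!-suc n) ⟩
    fromℕ (a (suc n)) * 1/! n                            ≡⟨ egfShift-coeff (λ n → a (suc n)) n ⟨
    egfShift (λ n → a (suc n)) n                         ∎

  egfShift-+ : ∀ a b → egfShift (λ n → a n ℕ.+ b n) ≈S (egfShift a +S egfShift b)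
  egfShift-+ a b n = begin
    egfShift (λ n → a n ℕ.+ b n) n               ≡⟨ egfShift-coeff (λ n → a n ℕ.+ b n) n ⟩
    fromℕ (a n ℕ.+ b n) * 1/! n                  ≡⟨ cong (_* 1/! n) (fromℕ-+ (a n) (b n)) ⟩
    (fromℕ (a n) + fromℕ (b n)) * 1/! n          ≡⟨ ℚP.*-distribʳ-+ (1/! n) (fromℕ (a n)) (fromℕ (b n)) ⟩
    fromℕ (a n) * 1/! n + fromℕ (b n) * 1/! n    ≡⟨ cong₂ _+_ (egfShift-coeff a n) (egfShift-coeff b n) ⟨
    egfShift a n + egfShift b n                  ∎

  egfShift-δ : egfShift δ ≈S oneS
  egfShift-δ zero    = refl
  egfShift-δ (suc n) = trans (egfShift-coeff δ (suc n)) (ℚP.*-zeroˡ (1/! (suc n)))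

  -- Both sides have the same constant term and satisfy the Leibniz rule, which the mask
  -- recursion (a ⊛ b) (n + 1) = (a′ ⊛ b) n + (a ⊛ b′) n mirrors.
  egfShift-⊛ : ∀ a b → (egfShift a *S egfShift b) ≈S egfShift (a ⊛ b)
  egfShift-⊛ a b zero = begin
    (egfShift a *S egfShift b) 0             ≡⟨ *S-coeff-zero (egfShift a) (egfShift b) ⟩
    egfShift a 0 * egfShift b 0              ≡⟨ cong₂ _*_ (egfShift-coeff a 0) (egfShift-coeff b 0) ⟩
    (fromℕ (a 0) * 1ℚ) * (fromℕ (b 0) * 1ℚ)  ≡⟨ cong₂ _*_ (ℚP.*-identityʳ (fromℕ (a 0))) (ℚP.*-identityʳ (fromℕ (b 0))) ⟩
    fromℕ (a 0) * fromℕ (b 0)                ≡⟨ fromℕ-* (a 0) (b 0) ⟨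
    fromℕ (a 0 ℕ.* b 0)                      ≡⟨ ℚP.*-identityʳ (fromℕ (a 0 ℕ.* b 0)) ⟨
    fromℕ (a 0 ℕ.* b 0) * 1ℚ                 ≡⟨ egfShift-coeff (a ⊛ b) 0 ⟨
    egfShift (a ⊛ b) 0                       ∎
  egfShift-⊛ a b (suc n) = fromℕ-*-cancelˡ (suc n) (begin
    D (egfShift a *S egfShift b) n
      ≡⟨ D-*S (egfShift a) (egfShift b) n ⟩
    (D (egfShift a) *S egfShift b) n + (egfShift a *S D (egfShift b)) n
      ≡⟨ cong₂ _+_ (*S-cong (D-egfShift a) (≈S-refl {egfShift b}) n) (*S-cong (≈S-refl {egfShift a}) (D-egfShift b) n) ⟩
    (egfShift a′ *S egfShift b) n + (egfShift a *S egfShift b′) n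
      ≡⟨ cong₂ _+_ (egfShift-⊛ a′ b n) (egfShift-⊛ a b′ n) ⟩
    egfShift (a′ ⊛ b) n + egfShift (a ⊛ b′) n
      ≡⟨ egfShift-+ (a′ ⊛ b) (a ⊛ b′) n ⟨
    egfShift (λ m → (a ⊛ b) (suc m)) n
      ≡⟨ D-egfShift (a ⊛ b) n ⟨
    D (egfShift (a ⊛ b)) n
      ∎)
    where
    a′ = λ n → a (suc n)
    b′ = λ n → b (suc n)


open import Data.Nat as ℕ using (ℕ; zero; suc)
open import Relation.Binary.PropositionalEquality using (_≡_; refl; sym; trans; cong)
open Enumeration using (δ; _⊛_)

module Solution (ℓ e o forests : ℕ → ℕ) (forests-zero : forests 0 ≡ 0)
  (forests-suc : ∀ m → forests (suc m) ≡ ℓ (suc m) ℕ.+ ((λ i → ℓ (suc i)) ⊛ forests) m)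
  (even-recurrence : ∀ m → e m ≡ δ m ℕ.+ (o ⊛ forests) m)
  (odd-recurrence : ∀ m → o m ≡ (e ⊛ forests) m) where

  open PowerSeries
  open import Data.Rational using (0ℚ; 1ℚ; _+_; _*_; _-_)
  import Data.Rational.Properties as ℚP
  import Data.Rational.Solver as ℚSolver
  open import Relation.Binary.Reasoning.Setoid FPS-setoid
  open ℚSolver.+-*-Solver using ()
    renaming (solve to ℚsolve; _:+_ to _⊕_; _:=_ to _≐_; con to ℚcon; _:-_ to _⊝_)

  L F X E O : FPS
  L = egf ℓ
  F = egfShift forests
  X = expS L
  E = egfShift e
  O = egfShift o

  two : FPS
  two = constS (1ℚ + 1ℚ)

  ℓ₀ : ℕ → ℕ
  ℓ₀ zero    = 0
  ℓ₀ (suc n) = ℓ (suc n)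

  egf≈egfShift : L ≈S egfShift ℓ₀
  egf≈egfShift zero    = refl
  egf≈egfShift (suc n) = refl

  D-egf : D L ≈S egfShift (λ n → ℓ (suc n))
  D-egf = ≈S-trans (D-cong egf≈egfShift) (D-egfShift ℓ₀)

  D-1+F : D (oneS +S F) ≈S (D L *S (oneS +S F))
  D-1+F = begin
    D (oneS +S F)                                                ≈⟨ D-+ oneS F ⟩
    D oneS +S D F                                                ≈⟨ (λ n → trans (cong (_+ D F n) (D-oneS n)) (ℚP.+-identityˡ (D F n))) ⟩
    D F                                                          ≈⟨ D-egfShift forests ⟩
    egfShift (λ n → forests (suc n))                             ≈⟨ egfShift-cong forests-suc ⟩
    egfShift (λ n → ℓ (suc n) ℕ.+ (ℓ′ ⊛ forests) n)              ≈⟨ egfShift-+ ℓ′ (ℓ′ ⊛ forests) ⟩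
    egfShift ℓ′ +S egfShift (ℓ′ ⊛ forests)                       ≈⟨ +S-cong (≈S-sym (*S-identityʳ (egfShift ℓ′))) (≈S-sym (egfShift-⊛ ℓ′ forests)) ⟩
    (egfShift ℓ′ *S oneS) +S (egfShift ℓ′ *S F)                  ≈⟨ ≈S-sym (*S-distribˡ-+ oneS F (egfShift ℓ′)) ⟩
    egfShift ℓ′ *S (oneS +S F)                                   ≈⟨ *S-cong (≈S-sym D-egf) (≈S-refl {oneS +S F}) ⟩
    D L *S (oneS +S F)                                           ∎
    where
    ℓ′ = λ n → ℓ (suc n)

  -- Both sides solve y′ = L′ y with y(0) = 1.
  expS-egf : X ≈S (oneS +S F)
  expS-egf = linear-ode-unique (D L) X (oneS +S F) (cong (1ℚ +_) (sym F0)) (D-expS L refl) D-1+F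
    where
    F0 : F 0 ≡ 0ℚ
    F0 = trans (egfShift-coeff forests 0) (cong (λ z → fromℕ z * 1ℚ) forests-zero)

  two-minus-expS : (two -S X) ≈S (oneS -S F)
  two-minus-expS zero    = trans (cong ((1ℚ + 1ℚ) -_) (expS-egf 0))
    (ℚsolve 1 (λ f → (ℚcon 1ℚ ⊕ ℚcon 1ℚ) ⊝ (ℚcon 1ℚ ⊕ f) ≐ ℚcon 1ℚ ⊝ f) refl (F 0))
  two-minus-expS (suc n) = trans (cong (0ℚ -_) (expS-egf (suc n)))
    (ℚsolve 1 (λ f → ℚcon 0ℚ ⊝ (ℚcon 0ℚ ⊕ f) ≐ ℚcon 0ℚ ⊝ f) refl (F (suc n)))

  expS-times-two-minus : (X *S (two -S X)) ≈S (oneS -S (F *S F))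
  expS-times-two-minus = begin
    X *S (two -S X)                                     ≈⟨ *S-cong expS-egf two-minus-expS ⟩
    (oneS +S F) *S (oneS -S F)                          ≈⟨ *S-distribʳ-+ oneS F (oneS -S F) ⟩
    (oneS *S (oneS -S F)) +S (F *S (oneS -S F))         ≈⟨ +S-cong (*S-identityˡ (oneS -S F)) (*S-distribˡ-- oneS F F) ⟩
    (oneS -S F) +S ((F *S oneS) -S (F *S F))            ≈⟨ +S-cong (≈S-refl {oneS -S F}) (-S-cong (*S-identityʳ F) (≈S-refl {F *S F})) ⟩
    (oneS -S F) +S (F -S (F *S F))                      ≈⟨ (λ n → ℚsolve 3 (λ a b c → (a ⊝ b) ⊕ (b ⊝ c) ≐ a ⊝ c) refl (oneS n) (F n) ((F *S F) n)) ⟩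
    oneS -S (F *S F)                                    ∎

  even-egf : E ≈S (oneS +S (O *S F))
  even-egf = begin
    E                                             ≈⟨ egfShift-cong even-recurrence ⟩
    egfShift (λ m → δ m ℕ.+ (o ⊛ forests) m)      ≈⟨ egfShift-+ δ (o ⊛ forests) ⟩
    egfShift δ +S egfShift (o ⊛ forests)          ≈⟨ +S-cong egfShift-δ (≈S-sym (egfShift-⊛ o forests)) ⟩
    oneS +S (O *S F)                              ∎

  odd-egf : O ≈S (E *S F)
  odd-egf = ≈S-trans (egfShift-cong odd-recurrence) (≈S-sym (egfShift-⊛ e forests))

  even-times-one-minus-F² : (E *S (oneS -S (F *S F))) ≈S oneS
  even-times-one-minus-F² = begin
    E *S (oneS -S (F *S F))              ≈⟨ *S-distribˡ-- oneS (F *S F) E ⟩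
    (E *S oneS) -S (E *S (F *S F))       ≈⟨ -S-cong (*S-identityʳ E) (≈S-sym (*S-assoc E F F)) ⟩
    E -S ((E *S F) *S F)                 ≈⟨ -S-cong (≈S-refl {E}) (*S-cong (≈S-sym odd-egf) (≈S-refl {F})) ⟩
    E -S (O *S F)                        ≈⟨ -S-cong even-egf (≈S-refl {O *S F}) ⟩
    (oneS +S (O *S F)) -S (O *S F)       ≈⟨ (λ n → ℚsolve 2 (λ a b → (a ⊕ b) ⊝ b ≐ a) refl (oneS n) ((O *S F) n)) ⟩
    oneS                                 ∎

  even-solution : (E *S (X *S (two -S X))) ≈S oneS
  even-solution = ≈S-trans (*S-cong (≈S-refl {E}) expS-times-two-minus) even-times-one-minus-F²

  odd-solution : (O *S (X *S (two -S X))) ≈S (X -S oneS)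
  odd-solution = begin
    O *S (X *S (two -S X))                 ≈⟨ *S-cong odd-egf expS-times-two-minus ⟩
    (E *S F) *S (oneS -S (F *S F))         ≈⟨ *S-cong (*S-comm E F) (≈S-refl {oneS -S (F *S F)}) ⟩
    (F *S E) *S (oneS -S (F *S F))         ≈⟨ *S-assoc F E (oneS -S (F *S F)) ⟩
    F *S (E *S (oneS -S (F *S F)))         ≈⟨ *S-cong (≈S-refl {F}) even-times-one-minus-F² ⟩
    F *S oneS                              ≈⟨ *S-identityʳ F ⟩
    F                                      ≈⟨ (λ n → ℚsolve 2 (λ a b → b ≐ (a ⊕ b) ⊝ a) refl (oneS n) (F n)) ⟩
    (oneS +S F) -S oneS                    ≈⟨ -S-cong (≈S-sym expS-egf) (≈S-refl {oneS}) ⟩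
    X -S oneS                              ∎

open import Data.Fin using (Fin)
open import Data.Product using (_×_; _,_)
open import Data.Rational using (1ℚ; _+_)
open import Function.Bundles using (_↔_)

proposition5p2 : (ℓ e o : ℕ → ℕ)
    → (∀ m → Tree (suc m) ↔ Fin (ℓ (suc m)))
    → (∀ m → EvenTree m ↔ Fin (e m))
    → (∀ m → OddTree m ↔ Fin (o m))
    → ((egfShift e *S (expS (egf ℓ) *S (constS (1ℚ + 1ℚ) -S expS (egf ℓ)))) ≈S oneS)
      × ((egfShift o *S (expS (egf ℓ) *S (constS (1ℚ + 1ℚ) -S expS (egf ℓ)))) ≈S (expS (egf ℓ) -S oneS))
proposition5p2 ℓ e o ℓ-count e-count o-count = S.even-solution , S.odd-solution
  where
  open Enumeration.TreeCounts ℓ ℓ-count using (forests; forests-suc)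
  open Enumeration.ParityCounts ℓ e o ℓ-count e-count o-count using (even-recurrence; odd-recurrence)
  module S = Solution ℓ e o forests refl forests-suc even-recurrence odd-recurrence
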